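{- Let $g$ be the morphism on $A_6=\{a,b,c,d,e,f\}$ defined by $g(a)=abac$, $g(b)=babd$, $g(c)=eabdf$, $g(d)=fbace$, $g(e)=bace$, $g(f)=abdf$, and let $h:A_6^*\to\{0,1\}^*$ be the morphism defined by $h(a)=10011$, $h(b)=01100$, $h(c)=01001$, $h(d)=10110$, $h(e)=0110$, $h(f)=1001$. Let $\mathbf{h}=h(g^\infty(a))$. Then $\mathbf{h}$ contains no factor of exponent larger than $7/3$; the squares occurring as factors of $\mathbf{h}$ are exactly the $12$ words $0^2$, $1^2$, $(01)^2$, $(10)^2$, $(001)^2$, $(010)^2$, $(011)^2$, $(100)^2$, $(101)^2$, $(110)^2$, $(01101001)^2$, $(10010110)^2$; and the words $0110110$ and $1001001$ are the only factors of $\mathbf{h}$ with exponent larger than $2$.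
   Context: $g^\infty(a)$ denotes the infinite word having every $g^k(a)$, $k\ge 1$, as a prefix, and $h$ is applied letter by letter to it. A word has period $p$ if its letters at distance $p$ are equal; the exponent of a nonempty finite word is its length divided by its smallest period. A square is a word $uu$ with $u$ nonempty. A factor is a contiguous finite subword. -}

module Defs where

open import Data.Nat using (ℕ; zero; suc; _+_; _*_; _<_; _≤_)
open import Data.List using (List; []; _∷_; _++_; length; concatMap; tabulate)
open import Data.Fin using (Fin; toℕ)
open import Data.Product using (Σ; ∃; _×_)
open import Relation.Binary.PropositionalEquality using (_≡_)

data A6 : Set where
  a b c d e f : A6

data Bit : Set where
  b0 b1 : Bit

g : A6 → List A6
g a = a ∷ b ∷ a ∷ c ∷ []
g b = b ∷ a ∷ b ∷ d ∷ []
g c = e ∷ a ∷ b ∷ d ∷ f ∷ []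
g d = f ∷ b ∷ a ∷ c ∷ e ∷ []
g e = b ∷ a ∷ c ∷ e ∷ []
g f = a ∷ b ∷ d ∷ f ∷ []

h : A6 → List Bit
h a = b1 ∷ b0 ∷ b0 ∷ b1 ∷ b1 ∷ []
h b = b0 ∷ b1 ∷ b1 ∷ b0 ∷ b0 ∷ []
h c = b0 ∷ b1 ∷ b0 ∷ b0 ∷ b1 ∷ []
h d = b1 ∷ b0 ∷ b1 ∷ b1 ∷ b0 ∷ []
h e = b0 ∷ b1 ∷ b1 ∷ b0 ∷ []
h f = b1 ∷ b0 ∷ b0 ∷ b1 ∷ []

morph : {X Y : Set} → (X → List Y) → List X → List Y
morph φ w = concatMap φ w

gIter : ℕ → List A6
gIter zero = a ∷ []
gIter (suc k) = morph g (gIter k)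

-- lookup with a default value (only used at indices that are in range)
lookupD : {X : Set} → X → List X → ℕ → X
lookupD x [] _ = x
lookupD x (y ∷ ys) zero = y
lookupD x (y ∷ ys) (suc i) = lookupD x ys i

-- g^∞(a) as an infinite word ℕ → A₆: letter i is letter i of g^(i+1)(a)
-- (|g^(i+1)(a)| ≥ 4^(i+1) > i, and every g^k(a) is a prefix of g^(k+1)(a))
gInf : ℕ → A6
gInf i = lookupD a (gIter (suc i)) i

-- The infinite binary word 𝐡 = h(g^∞(a)), obtained by applying h letter by
-- letter; letter i is letter i of h(g^(i+1)(a)) (whose length exceeds i).
hInf : ℕ → Bit
hInf i = lookupD b0 (morph h (gIter (suc i))) i

IsFactor : {X : Set} → (ℕ → X) → List X → Set
IsFactor {X} x w = Σ ℕ λ i → w ≡ tabulate {n = length w} (λ j → x (i + toℕ j))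

HasPeriod : {X : Set} → List X → ℕ → Set
HasPeriod {X} w p = (1 ≤ p) × (∀ i → i + p < length w → ∀ (x : X) →
                     lookupD x w i ≡ lookupD x w (i + p))

SmallestPeriod : {X : Set} → List X → ℕ → Set
SmallestPeriod w p = HasPeriod w p × (∀ q → HasPeriod w q → p ≤ q)

module Submission where

-- Both g and h send every letter to a word of length 4 or 5.  Hence a long factor of x = g^∞(a),
-- or of 𝐡 = h(x), lies inside the image of a short factor of x, and everything about short factors
-- is settled by evaluating finite certificates: the factors of x of length 4 and 5 (a set closed
-- under g), decoders that recognise the cuts between letter images from a window of bounded length,
-- and the repetitions of small period inside g³ or h(g²) of short factors.
--
-- The decoders give desubstitution: a long repetition of period p in φ(x) (φ = g or h) comes from
-- a repetition of period q, with 4q ≤ p ≤ 5q, and length q ∸ 3 in x.  By strong induction x has no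
-- such repetition with q ≥ 14, so 𝐡 has no square of period at least 70; all shorter periods of 𝐡
-- are covered by its certificate, which yields the exponent bound, the list of squares and the list
-- of overlaps.

open import Defs
open import Data.Bool using (Bool; true; false; T; _∧_; if_then_else_)
open import Data.Bool.ListAction using (all; any)
open import Data.Bool.Properties using (T-∧)
open import Data.Empty using (⊥-elim)
open import Data.Fin as Fin using (Fin; toℕ)
open import Data.List using (List; []; _∷_; _++_; length; take; drop; tabulate; applyUpTo)
open import Data.List.Membership.Propositional using (_∈_)
open import Data.List.Properties
  using (length-++; ++-assoc; ++-identityʳ; ++-cancelˡ; concatMap-++; take++drop≡id; length-drop; drop-drop)
open import Data.List.Relation.Unary.All as All using ()
open import Data.List.Relation.Unary.All.Properties using (all⁺; applyUpTo⁻)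
open import Data.List.Relation.Unary.Any as Any using (here; there)
open import Data.List.Relation.Unary.Any.Properties using (any⁻)
open import Data.Maybe using (Maybe; just; nothing)
open import Data.Maybe.Properties using (just-injective)
open import Data.Nat
open import Data.Nat.Induction using (<-rec)
open import Data.Nat.Properties
open import Data.Nat.Tactic.RingSolver using (solve-∀)
open import Data.Product using (Σ; _×_; _,_; proj₁; proj₂)
open import Data.Sum using (_⊎_; inj₁; inj₂)
open import Data.Unit using (tt)
open import Function using (_∘_)
open import Function.Bundles using (Equivalence; _⇔_; mk⇔)
open import Relation.Binary.PropositionalEquality
open import Relation.Nullary using (¬_; yes; no)

window : {X : Set} → (ℕ → X) → ℕ → ℕ → List X
window x i zero    = []
window x i (suc n) = x i ∷ window x (suc i) n

length-window : {X : Set} (x : ℕ → X) (i n : ℕ) → length (window x i n) ≡ n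
length-window x i zero    = refl
length-window x i (suc n) = cong suc (length-window x (suc i) n)

lookup-window : {X : Set} (x₀ : X) (x : ℕ → X) (i n t : ℕ) → t < n →
                lookupD x₀ (window x i n) t ≡ x (i + t)
lookup-window x₀ x i (suc n) zero    _         = cong x (sym (+-identityʳ i))
lookup-window x₀ x i (suc n) (suc t) (s≤s t<n) =
  trans (lookup-window x₀ x (suc i) n t t<n) (cong x (sym (+-suc i t)))

window-++ : {X : Set} (x : ℕ → X) (i m n : ℕ) →
            window x i (m + n) ≡ window x i m ++ window x (i + m) n
window-++ x i zero    n = cong (λ k → window x k n) (sym (+-identityʳ i))
window-++ x i (suc m) n = cong (x i ∷_) (trans (window-++ x (suc i) m n)
  (cong (λ k → window x (suc i) m ++ window x k n) (sym (+-suc i m))))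

window-cong : {X : Set} (x y : ℕ → X) (i j n : ℕ) → (∀ t → t < n → x (i + t) ≡ y (j + t)) →
              window x i n ≡ window y j n
window-cong x y i j zero    _  = refl
window-cong x y i j (suc n) eq = cong₂ _∷_ head (window-cong x y (suc i) (suc j) n tail)
  where
  head : x i ≡ y j
  head = trans (cong x (sym (+-identityʳ i))) (trans (eq 0 z<s) (cong y (+-identityʳ j)))
  tail : ∀ t → t < n → x (suc i + t) ≡ y (suc j + t)
  tail t t<n = trans (cong x (sym (+-suc i t))) (trans (eq (suc t) (s<s t<n)) (cong y (+-suc j t)))

take-window : {X : Set} (x : ℕ → X) (i m n : ℕ) → m ≤ n → take m (window x i n) ≡ window x i m
take-window x i zero    n       _         = refl
take-window x i (suc m) (suc n) (s≤s m≤n) = cong (x i ∷_) (take-window x (suc i) m n m≤n)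

drop-window : {X : Set} (x : ℕ → X) (i r n : ℕ) → r ≤ n → drop r (window x i n) ≡ window x (i + r) (n ∸ r)
drop-window x i zero    n       _         = cong (λ k → window x k n) (sym (+-identityʳ i))
drop-window x i (suc r) (suc n) (s≤s r≤n) =
  trans (drop-window x (suc i) r n r≤n) (cong (λ k → window x k (n ∸ r)) (sym (+-suc i r)))

take-drop-window : {X : Set} (x : ℕ → X) (i r m n : ℕ) → r + m ≤ n →
                   take m (drop r (window x i n)) ≡ window x (i + r) m
take-drop-window x i r m n r+m≤n =
  trans (cong (take m) (drop-window x i r n (≤-trans (m≤m+n r m) r+m≤n)))
        (take-window x (i + r) m (n ∸ r) (subst (_≤ n ∸ r) (m+n∸m≡n r m) (∸-monoˡ-≤ r r+m≤n)))

window-from-lookups : {X : Set} (x₀ : X) (x : ℕ → X) (L : List X) (i m : ℕ) →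
                      (∀ t → t < length L → x (i + t) ≡ lookupD x₀ L t) → m ≤ length L →
                      window x i m ≡ take m L
window-from-lookups x₀ x L       i zero    _  _         = refl
window-from-lookups x₀ x (y ∷ L) i (suc m) eq (s≤s m≤L) =
  cong₂ _∷_ (trans (cong x (sym (+-identityʳ i))) (eq 0 z<s))
            (window-from-lookups x₀ x L (suc i) m tail m≤L)
  where
  tail : ∀ t → t < length L → x (suc i + t) ≡ lookupD x₀ L t
  tail t t<L = trans (cong x (sym (+-suc i t))) (eq (suc t) (s<s t<L))

factor⇒window : {X : Set} (x : ℕ → X) (w : List X) → IsFactor x w → Σ ℕ λ i → w ≡ window x i (length w)
factor⇒window x w (i , w≡) = i , trans w≡ (tabulate-window (length w) _ i (λ _ → refl))
  where
  tabulate-window : (n : ℕ) (F : Fin n → _) (i : ℕ) → (∀ t → F t ≡ x (i + toℕ t)) → tabulate F ≡ window x i n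
  tabulate-window zero    F i eq = refl
  tabulate-window (suc n) F i eq =
    cong₂ _∷_ (trans (eq Fin.zero) (cong x (+-identityʳ i)))
              (tabulate-window n (F ∘ Fin.suc) (suc i) (λ t → trans (eq (Fin.suc t)) (cong x (+-suc i (toℕ t)))))

lookup-++ˡ : {X : Set} (x₀ : X) (u v : List X) (t : ℕ) → t < length u → lookupD x₀ (u ++ v) t ≡ lookupD x₀ u t
lookup-++ˡ x₀ (x ∷ u) v zero    _         = refl
lookup-++ˡ x₀ (x ∷ u) v (suc t) (s≤s t<u) = lookup-++ˡ x₀ u v t t<u

lookup-++ʳ : {X : Set} (x₀ : X) (u v : List X) (t : ℕ) → lookupD x₀ (u ++ v) (length u + t) ≡ lookupD x₀ v t
lookup-++ʳ x₀ []      v t = refl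
lookup-++ʳ x₀ (x ∷ u) v t = lookup-++ʳ x₀ u v t

lookup-drop : {X : Set} (x₀ : X) (L : List X) (k t : ℕ) → lookupD x₀ (drop k L) t ≡ lookupD x₀ L (k + t)
lookup-drop x₀ L       zero    t = refl
lookup-drop x₀ []      (suc k) t = refl
lookup-drop x₀ (x ∷ L) (suc k) t = lookup-drop x₀ L k t

take-length-++ : {X : Set} (u v : List X) → take (length u) (u ++ v) ≡ u
take-length-++ []      v = refl
take-length-++ (x ∷ u) v = cong (x ∷_) (take-length-++ u v)

drop-length-++ : {X : Set} (u v : List X) → drop (length u) (u ++ v) ≡ v
drop-length-++ []      v = refl
drop-length-++ (x ∷ u) v = drop-length-++ u v

take-++ˡ : {X : Set} (m : ℕ) (u v : List X) → m ≤ length u → take m (u ++ v) ≡ take m u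
take-++ˡ zero    u       v _         = refl
take-++ˡ (suc m) (x ∷ u) v (s≤s m≤u) = cong (x ∷_) (take-++ˡ m u v m≤u)

-- u occurs in s, cut as s = before ++ u ++ after; offset is the position of the occurrence.
-- (A record rather than a Σ-type, so that the two lists are recovered by unification.)
record Infix {X : Set} (u s : List X) : Set where
  constructor mkInfix
  field
    before after : List X
    splits       : s ≡ before ++ u ++ after

offset : {X : Set} {u s : List X} → Infix u s → ℕ
offset I = length (Infix.before I)

infix-trans : {X : Set} {u s t : List X} → Infix u s → Infix s t → Infix u t
infix-trans {u = u} (mkInfix l₁ r₁ s≡) (mkInfix l₂ r₂ t≡) = mkInfix (l₂ ++ l₁) (r₁ ++ r₂) (begin
    _                            ≡⟨ t≡ ⟩
    l₂ ++ _ ++ r₂                ≡⟨ cong (λ s → l₂ ++ s ++ r₂) s≡ ⟩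
    l₂ ++ (l₁ ++ u ++ r₁) ++ r₂  ≡⟨ cong (l₂ ++_) (++-assoc l₁ (u ++ r₁) r₂) ⟩
    l₂ ++ l₁ ++ (u ++ r₁) ++ r₂  ≡⟨ cong (λ v → l₂ ++ l₁ ++ v) (++-assoc u r₁ r₂) ⟩
    l₂ ++ l₁ ++ u ++ r₁ ++ r₂    ≡⟨ ++-assoc l₂ l₁ _ ⟨
    (l₂ ++ l₁) ++ u ++ r₁ ++ r₂  ∎)
  where open ≡-Reasoning

infix-morph : {X Y : Set} (φ : X → List Y) {u s : List X} → Infix u s → Infix (morph φ u) (morph φ s)
infix-morph φ {u} (mkInfix l r s≡) = mkInfix (morph φ l) (morph φ r)
  (trans (cong (morph φ) s≡) (trans (concatMap-++ φ l (u ++ r)) (cong (morph φ l ++_) (concatMap-++ φ u r))))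

infix-lookup : {X : Set} (x₀ : X) {u s : List X} (I : Infix u s) (t : ℕ) → t < length u →
               lookupD x₀ s (offset I + t) ≡ lookupD x₀ u t
infix-lookup x₀ {u} (mkInfix l r s≡) t t<u =
  trans (cong (λ s → lookupD x₀ s (length l + t)) s≡) (trans (lookup-++ʳ x₀ l (u ++ r) t) (lookup-++ˡ x₀ u r t t<u))

infix-length : {X : Set} {u s : List X} (I : Infix u s) → offset I + length u ≤ length s
infix-length {u = u} (mkInfix l r refl) rewrite length-++ l {u ++ r} | length-++ u {r} =
  +-monoʳ-≤ (length l) (m≤m+n (length u) (length r))

infix-take-drop : {X : Set} {u s : List X} (I : Infix u s) → take (length u) (drop (offset I) s) ≡ u
infix-take-drop {u = u} (mkInfix l r refl) = trans (cong (take (length u)) (drop-length-++ l (u ++ r))) (take-length-++ u r)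

infix-suffix : {X : Set} {u s : List X} (I : Infix u s) → drop (offset I) s ≡ u ++ Infix.after I
infix-suffix {u = u} (mkInfix l r refl) = drop-length-++ l (u ++ r)

-- x[i, i+P+p) has period p: the first P of its letters repeat p positions later.
-- A factor with period p and length L is a Repetition of length L ∸ p.
Repetition : {X : Set} → (ℕ → X) → ℕ → ℕ → ℕ → Set
Repetition x i p P = ∀ t → t < P → x (i + t) ≡ x (i + t + p)

repetition-≤ : {X : Set} {x : ℕ → X} {i p P P′ : ℕ} → P′ ≤ P → Repetition x i p P → Repetition x i p P′
repetition-≤ P′≤P rep t t<P′ = rep t (<-≤-trans t<P′ P′≤P)

repetition-window : {X : Set} {x : ℕ → X} {i p P : ℕ} → Repetition x i p P →
                    ∀ s n → i ≤ s → s + n ≤ i + P → window x s n ≡ window x (s + p) n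
repetition-window {x = x} {i} {p} {P} rep s n i≤s s+n≤i+P with m≤n⇒∃[o]m+o≡n i≤s
... | z , refl = window-cong x x (i + z) (i + z + p) n shifted
  where
  shifted : ∀ t → t < n → x (i + z + t) ≡ x (i + z + p + t)
  shifted t t<n = trans (cong x (reassoc₁ i z t)) (trans (rep (z + t) z+t<P) (cong x (reassoc₂ i z t p)))
    where
    reassoc₁ : ∀ i z t → i + z + t ≡ i + (z + t)
    reassoc₁ = solve-∀
    reassoc₂ : ∀ i z t p → i + (z + t) + p ≡ i + z + p + t
    reassoc₂ = solve-∀
    z+t<P : z + t < P
    z+t<P = +-cancelˡ-< i _ _ (subst (_< i + P) (reassoc₁ i z t)
              (<-≤-trans (+-monoʳ-< (i + z) t<n) s+n≤i+P))

periodic-window : {X : Set} (x : ℕ → X) (w : List X) (i p : ℕ) → w ≡ window x i (length w) → HasPeriod w p →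
                  Repetition x i p (length w ∸ p)
periodic-window x w i p w≡ (_ , period) t t<L∸p = begin
    x (i + t)                            ≡⟨ lookup-window (x i) x i (length w) t t<L ⟨
    lookupD (x i) (window x i L) t       ≡⟨ cong (λ v → lookupD (x i) v t) w≡ ⟨
    lookupD (x i) w t                    ≡⟨ period t t+p<L (x i) ⟩
    lookupD (x i) w (t + p)              ≡⟨ cong (λ v → lookupD (x i) v (t + p)) w≡ ⟩
    lookupD (x i) (window x i L) (t + p) ≡⟨ lookup-window (x i) x i (length w) (t + p) t+p<L ⟩
    x (i + (t + p))                      ≡⟨ cong x (+-assoc i t p) ⟨
    x (i + t + p)                        ∎
  where
  open ≡-Reasoning
  L = length w
  p≤L : p ≤ L
  p≤L = ≮⇒≥ (λ L<p → <⇒≱ t<L∸p (subst (_≤ t) (sym (m≤n⇒m∸n≡0 (<⇒≤ L<p))) z≤n))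
  t+p<L : t + p < L
  t+p<L = subst (t + p <_) (m∸n+n≡m p≤L) (+-monoˡ-< p t<L∸p)
  t<L : t < L
  t<L = ≤-<-trans (m≤m+n t p) t+p<L

square-period : {X : Set} (u : List X) → u ≢ [] → HasPeriod (u ++ u) (length u)
square-period []      u≢[] = ⊥-elim (u≢[] refl)
square-period (y ∷ u) _    = s≤s z≤n , shifted
  where
  v = y ∷ u
  shifted : ∀ t → t + length v < length (v ++ v) → ∀ x₀ → lookupD x₀ (v ++ v) t ≡ lookupD x₀ (v ++ v) (t + length v)
  shifted t t+p<2p x₀ = begin
      lookupD x₀ (v ++ v) t                ≡⟨ lookup-++ˡ x₀ v v t t<v ⟩
      lookupD x₀ v t                       ≡⟨ lookup-++ʳ x₀ v v t ⟨
      lookupD x₀ (v ++ v) (length v + t)   ≡⟨ cong (lookupD x₀ (v ++ v)) (+-comm (length v) t) ⟩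
      lookupD x₀ (v ++ v) (t + length v)   ∎
    where
    open ≡-Reasoning
    t<v : t < length v
    t<v = +-cancelʳ-< (length v) t (length v) (subst (t + length v <_) (length-++ v) t+p<2p)

length-morph-≥ : {X Y : Set} (φ : X → List Y) (m : ℕ) → (∀ x → m ≤ length (φ x)) →
                 ∀ u → m * length u ≤ length (morph φ u)
length-morph-≥ φ m φ≥ []      = ≤-reflexive (*-zeroʳ m)
length-morph-≥ φ m φ≥ (x ∷ u) rewrite length-++ (φ x) {morph φ u} | *-suc m (length u) =
  +-mono-≤ (φ≥ x) (length-morph-≥ φ m φ≥ u)

length-morph-≤ : {X Y : Set} (φ : X → List Y) (m : ℕ) → (∀ x → length (φ x) ≤ m) →
                 ∀ u → length (morph φ u) ≤ m * length u
length-morph-≤ φ m φ≤ []      = ≤-reflexive (sym (*-zeroʳ m))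
length-morph-≤ φ m φ≤ (x ∷ u) rewrite length-++ (φ x) {morph φ u} | *-suc m (length u) =
  +-mono-≤ (φ≤ x) (length-morph-≤ φ m φ≤ u)

g-≥4 : ∀ x → 4 ≤ length (g x)
g-≥4 a = ≤ᵇ⇒≤ _ _ _
g-≥4 b = ≤ᵇ⇒≤ _ _ _
g-≥4 c = ≤ᵇ⇒≤ _ _ _
g-≥4 d = ≤ᵇ⇒≤ _ _ _
g-≥4 e = ≤ᵇ⇒≤ _ _ _
g-≥4 f = ≤ᵇ⇒≤ _ _ _

g-≤5 : ∀ x → length (g x) ≤ 5
g-≤5 a = ≤ᵇ⇒≤ _ _ _
g-≤5 b = ≤ᵇ⇒≤ _ _ _
g-≤5 c = ≤ᵇ⇒≤ _ _ _
g-≤5 d = ≤ᵇ⇒≤ _ _ _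
g-≤5 e = ≤ᵇ⇒≤ _ _ _
g-≤5 f = ≤ᵇ⇒≤ _ _ _

h-≥4 : ∀ x → 4 ≤ length (h x)
h-≥4 a = ≤ᵇ⇒≤ _ _ _
h-≥4 b = ≤ᵇ⇒≤ _ _ _
h-≥4 c = ≤ᵇ⇒≤ _ _ _
h-≥4 d = ≤ᵇ⇒≤ _ _ _
h-≥4 e = ≤ᵇ⇒≤ _ _ _
h-≥4 f = ≤ᵇ⇒≤ _ _ _

h-≤5 : ∀ x → length (h x) ≤ 5
h-≤5 a = ≤ᵇ⇒≤ _ _ _
h-≤5 b = ≤ᵇ⇒≤ _ _ _
h-≤5 c = ≤ᵇ⇒≤ _ _ _
h-≤5 d = ≤ᵇ⇒≤ _ _ _
h-≤5 e = ≤ᵇ⇒≤ _ _ _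
h-≤5 f = ≤ᵇ⇒≤ _ _ _

gIter-prefix : ∀ k → Σ (List A6) λ r → gIter (suc k) ≡ gIter k ++ r
gIter-prefix zero    = b ∷ a ∷ c ∷ [] , refl
gIter-prefix (suc k) with gIter-prefix k
... | r , eq = morph g r , trans (cong (morph g) eq) (concatMap-++ g (gIter k) r)

gIter-prefix-≤ : ∀ k m → k ≤ m → Σ (List A6) λ r → gIter m ≡ gIter k ++ r
gIter-prefix-≤ k m k≤m with m≤n⇒∃[o]m+o≡n k≤m
... | o , refl = go o
  where
  go : ∀ o → Σ (List A6) λ r → gIter (k + o) ≡ gIter k ++ r
  go zero    = [] , trans (cong gIter (+-identityʳ k)) (sym (++-identityʳ (gIter k)))
  go (suc o) with go o | gIter-prefix (k + o)
  ... | r , eq | r′ , eq′ = r ++ r′ ,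
    trans (cong gIter (+-suc k o)) (trans eq′ (trans (cong (_++ r′) eq) (++-assoc (gIter k) r r′)))

length-gIter : ∀ k → suc k ≤ length (gIter k)
length-gIter zero    = s≤s z≤n
length-gIter (suc k) =
  ≤-trans (+-monoʳ-≤ 1 (length-gIter k))
  (≤-trans (1+n≤4n (length (gIter k)) (≤-trans (s≤s z≤n) (length-gIter k)))
           (length-morph-≥ g 4 g-≥4 (gIter k)))
  where
  1+n≤4n : ∀ n → 1 ≤ n → 1 + n ≤ 4 * n
  1+n≤4n n 1≤n = ≤-trans (+-monoˡ-≤ n 1≤n) (+-monoʳ-≤ n (m≤m+n n _))

morph-gIter-prefix : {Y : Set} (φ : A6 → List Y) (k m : ℕ) → k ≤ m →
                     Σ (List Y) λ r → morph φ (gIter m) ≡ morph φ (gIter k) ++ r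
morph-gIter-prefix φ k m k≤m with gIter-prefix-≤ k m k≤m
... | r , eq = morph φ r , trans (cong (morph φ) eq) (concatMap-++ φ (gIter k) r)

-- If letter i of w is read off some φ(g^k(a)) long enough, it can be read off any such image long enough:
-- the images form a chain of prefixes.
read-anywhere : {Y : Set} (y₀ : Y) (φ : A6 → List Y) (w : ℕ → Y) →
  (∀ i → Σ ℕ λ k → i < length (morph φ (gIter k)) × w i ≡ lookupD y₀ (morph φ (gIter k)) i) →
  ∀ i k → i < length (morph φ (gIter k)) → w i ≡ lookupD y₀ (morph φ (gIter k)) i
read-anywhere y₀ φ w read i k i<k with read i
... | k₀ , i<k₀ , w≡ with ≤-total k₀ k
...   | inj₁ k₀≤k with morph-gIter-prefix φ k₀ k k₀≤k
...     | r , eq = trans w≡ (sym (trans (cong (λ z → lookupD y₀ z i) eq) (lookup-++ˡ y₀ (morph φ (gIter k₀)) r i i<k₀)))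
read-anywhere y₀ φ w read i k i<k | k₀ , i<k₀ , w≡ | inj₂ k≤k₀ with morph-gIter-prefix φ k k₀ k≤k₀
...     | r , eq = trans w≡ (trans (cong (λ z → lookupD y₀ z i) eq) (lookup-++ˡ y₀ (morph φ (gIter k)) r i i<k))

gInf-read : ∀ i k → i < length (gIter (suc k)) → gInf i ≡ lookupD a (gIter (suc k)) i
gInf-read = read-anywhere a g gInf (λ i → i , ≤-trans (n≤1+n (suc i)) (length-gIter (suc i)) , refl)

hInf-read : ∀ i k → i < length (morph h (gIter k)) → hInf i ≡ lookupD b0 (morph h (gIter k)) i
hInf-read = read-anywhere b0 h hInf (λ i → suc i , long i , refl)
  where
  long : ∀ i → i < length (morph h (gIter (suc i)))
  long i = ≤-trans (≤-trans (n≤1+n (suc i)) (length-gIter (suc i)))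
                   (≤-trans (m≤n*m _ 4) (length-morph-≥ h 4 h-≥4 (gIter (suc i))))

IsImage : {X Y : Set} → (X → List Y) → (ℕ → X) → (ℕ → Y) → Set
IsImage φ x w = ∀ n → window w 0 (length (morph φ (window x 0 n))) ≡ morph φ (window x 0 n)

image-of-gInf : {Y : Set} (y₀ : Y) (φ : A6 → List Y) (w : ℕ → Y) →
  (∀ i k → i < length (morph φ (gIter k)) → w i ≡ lookupD y₀ (morph φ (gIter k)) i) → IsImage φ gInf w
image-of-gInf y₀ φ w read n = begin
    window w 0 (length (morph φ P))
  ≡⟨ window-from-lookups y₀ w (morph φ G) 0 _ (λ t → read t (suc n)) φP≤φG ⟩
    take (length (morph φ P)) (morph φ G)
  ≡⟨ cong (take _) φG≡ ⟩
    take (length (morph φ P)) (morph φ P ++ morph φ (drop n G))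
  ≡⟨ take-length-++ (morph φ P) _ ⟩
    morph φ P ∎
  where
  open ≡-Reasoning
  G = gIter (suc n)
  P = window gInf 0 n
  P≡ : P ≡ take n G
  P≡ = window-from-lookups a gInf G 0 n (λ t → gInf-read t n) (≤-trans (≤-trans (n≤1+n n) (n≤1+n (suc n))) (length-gIter (suc n)))
  φG≡ : morph φ G ≡ morph φ P ++ morph φ (drop n G)
  φG≡ = trans (cong (morph φ) (trans (sym (take++drop≡id n G)) (cong (_++ drop n G) (sym P≡))))
              (concatMap-++ φ P (drop n G))
  φP≤φG : length (morph φ P) ≤ length (morph φ G)
  φP≤φG = subst (λ z → length (morph φ P) ≤ length z) (sym φG≡)
                (subst (length (morph φ P) ≤_) (sym (length-++ (morph φ P))) (m≤m+n _ _))

gInf-image : IsImage g gInf gInf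
gInf-image = image-of-gInf a g gInf gInf-read

hInf-image : IsImage h gInf hInf
hInf-image = image-of-gInf b0 h hInf hInf-read

-- Cuts and blocks of an image w = φ(x) under a morphism with letter images of length 4 or 5:
-- block j n = φ(x[j, j+n)) and cut j = |φ(x[0, j))| is the position in w where φ(x_j) starts.
module Image {X Y : Set} (φ : X → List Y) (φ-≥4 : ∀ x → 4 ≤ length (φ x)) (φ-≤5 : ∀ x → length (φ x) ≤ 5)
             (x : ℕ → X) (w : ℕ → Y) (w-image : IsImage φ x w) where

  block : ℕ → ℕ → List Y
  block j n = morph φ (window x j n)

  cut : ℕ → ℕ
  cut j = length (block 0 j)

  block-++ : ∀ j m n → block j (m + n) ≡ block j m ++ block (j + m) n
  block-++ j m n = trans (cong (morph φ) (window-++ x j m n)) (concatMap-++ φ (window x j m) _)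

  length-block-≥ : ∀ j n → 4 * n ≤ length (block j n)
  length-block-≥ j n = subst (λ k → 4 * k ≤ length (block j n)) (length-window x j n)
                             (length-morph-≥ φ 4 φ-≥4 (window x j n))

  length-block-≤ : ∀ j n → length (block j n) ≤ 5 * n
  length-block-≤ j n = subst (λ k → length (block j n) ≤ 5 * k) (length-window x j n)
                             (length-morph-≤ φ 5 φ-≤5 (window x j n))

  length-block-+ : ∀ j m n → length (block j (m + n)) ≡ length (block j m) + length (block (j + m) n)
  length-block-+ j m n = trans (cong length (block-++ j m n)) (length-++ (block j m))

  length-block-suc : ∀ j n → length (block j (suc n)) ≡ length (block j n) + length (φ (x (j + n)))
  length-block-suc j n = begin
      length (block j (suc n))                          ≡⟨ cong (length ∘ block j) (+-comm 1 n) ⟩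
      length (block j (n + 1))                          ≡⟨ length-block-+ j n 1 ⟩
      length (block j n) + length (φ (x (j + n)) ++ []) ≡⟨ cong (λ u → length (block j n) + length u) (++-identityʳ (φ (x (j + n)))) ⟩
      length (block j n) + length (φ (x (j + n)))       ∎
    where open ≡-Reasoning

  length-block-mono : ∀ j {m n} → m ≤ n → length (block j m) ≤ length (block j n)
  length-block-mono j {m} {n} m≤n = subst (λ k → length (block j m) ≤ length (block j k)) (m+[n∸m]≡n m≤n)
    (subst (length (block j m) ≤_) (sym (length-block-+ j m (n ∸ m))) (m≤m+n _ _))

  cut-+ : ∀ j k → cut (j + k) ≡ cut j + length (block j k)
  cut-+ = length-block-+ 0

  cut-suc : ∀ j → cut (suc j) ≡ cut j + length (φ (x j))
  cut-suc = length-block-suc 0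

  cut-+-≥ : ∀ j k → cut j + 4 * k ≤ cut (j + k)
  cut-+-≥ j k = subst (cut j + 4 * k ≤_) (sym (cut-+ j k)) (+-monoʳ-≤ (cut j) (length-block-≥ j k))

  cut-+-≤ : ∀ j k → cut (j + k) ≤ cut j + 5 * k
  cut-+-≤ j k = subst (_≤ cut j + 5 * k) (sym (cut-+ j k)) (+-monoʳ-≤ (cut j) (length-block-≤ j k))

  cut-suc-≥ : ∀ j → cut j + 4 ≤ cut (suc j)
  cut-suc-≥ j = subst (cut j + 4 ≤_) (sym (cut-suc j)) (+-monoʳ-≤ (cut j) (φ-≥4 (x j)))

  cut-suc-≤ : ∀ j → cut (suc j) ≤ cut j + 5
  cut-suc-≤ j = subst (_≤ cut j + 5) (sym (cut-suc j)) (+-monoʳ-≤ (cut j) (φ-≤5 (x j)))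

  cut-mono-≤ : ∀ {j j′} → j ≤ j′ → cut j ≤ cut j′
  cut-mono-≤ {j} {j′} j≤j′ = subst (λ k → cut j ≤ cut k) (m+[n∸m]≡n j≤j′)
    (≤-trans (m≤m+n (cut j) _) (cut-+-≥ j (j′ ∸ j)))

  cut-mono-< : ∀ {j j′} → j < j′ → cut j < cut j′
  cut-mono-< {j} j<j′ = <-≤-trans (<-≤-trans (m<m+n (cut j) (s≤s z≤n)) (cut-suc-≥ j)) (cut-mono-≤ j<j′)

  locate : ∀ i → Σ ℕ λ j → cut j ≤ i × i < cut (suc j)
  locate zero    = 0 , z≤n , <-≤-trans (s≤s z≤n) (cut-suc-≥ 0)
  locate (suc i) with locate i
  ... | j , j≤i , i<j+1 with m≤n⇒m<n∨m≡n i<j+1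
  ...   | inj₁ i+1<j+1 = j , m≤n⇒m≤1+n j≤i , i+1<j+1
  ...   | inj₂ i+1≡j+1 = suc j , ≤-reflexive (sym i+1≡j+1) ,
          subst (_< cut (suc (suc j))) (sym i+1≡j+1) (cut-mono-< {suc j} ≤-refl)

  window-at-cut : ∀ j n → window w (cut j) (length (block j n)) ≡ block j n
  window-at-cut j n = ++-cancelˡ (block 0 j) _ _ (begin
      block 0 j ++ window w (cut j) (length (block j n))           ≡⟨ cong (_++ window w (cut j) (length (block j n))) (sym (w-image j)) ⟩
      window w 0 (cut j) ++ window w (cut j) (length (block j n))  ≡⟨ window-++ w 0 (cut j) _ ⟨
      window w 0 (cut j + length (block j n))                       ≡⟨ cong (window w 0) (cut-+ j n) ⟨
      window w 0 (cut (j + n))                                      ≡⟨ w-image (j + n) ⟩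
      block 0 (j + n)                                               ≡⟨ block-++ 0 j n ⟩
      block 0 j ++ block j n                                        ∎)
    where open ≡-Reasoning

  window-in-block : ∀ i n k → n + 4 ≤ 4 * k →
    Σ ℕ λ j → 4 * j ≤ i × Σ (Infix (window w i n) (block j k)) λ I → offset I ≤ 4
  window-in-block i n k n+4≤4k with locate i
  ... | j , cj≤i , i<cj+1 = j , ≤-trans (cut-+-≥ 0 j) cj≤i , mkInfix (window w (cut j) r) (window w (i + n) (L ∸ r ∸ n)) split , r≤4′
    where
    L = length (block j k)
    r = i ∸ cut j
    r≤4 : r ≤ 4
    r≤4 = ≤-pred (+-cancelˡ-< (cut j) _ _ (subst (_< cut j + 5) (sym (m+[n∸m]≡n cj≤i)) (<-≤-trans i<cj+1 (cut-suc-≤ j))))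
    r≤4′ : length (window w (cut j) r) ≤ 4
    r≤4′ = subst (_≤ 4) (sym (length-window w (cut j) r)) r≤4
    r+n≤L : r + n ≤ L
    r+n≤L = ≤-trans (subst (r + n ≤_) (+-comm 4 n) (+-monoˡ-≤ n r≤4)) (≤-trans n+4≤4k (length-block-≥ j k))
    n≤L∸r : n ≤ L ∸ r
    n≤L∸r = subst (_≤ L ∸ r) (m+n∸m≡n r n) (∸-monoˡ-≤ r r+n≤L)
    split : block j k ≡ window w (cut j) r ++ window w i n ++ window w (i + n) (L ∸ r ∸ n)
    split = begin
        block j k                                                          ≡⟨ window-at-cut j k ⟨
        window w (cut j) L                                                 ≡⟨ cong (window w (cut j)) (m+[n∸m]≡n (≤-trans (m≤m+n r n) r+n≤L)) ⟨
        window w (cut j) (r + (L ∸ r))                                     ≡⟨ window-++ w (cut j) r (L ∸ r) ⟩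
        window w (cut j) r ++ window w (cut j + r) (L ∸ r)                 ≡⟨ cong (λ s → window w (cut j) r ++ window w s (L ∸ r)) (m+[n∸m]≡n cj≤i) ⟩
        window w (cut j) r ++ window w i (L ∸ r)                           ≡⟨ cong (λ m → window w (cut j) r ++ window w i m) (m+[n∸m]≡n n≤L∸r) ⟨
        window w (cut j) r ++ window w i (n + (L ∸ r ∸ n))                 ≡⟨ cong (window w (cut j) r ++_) (window-++ w i n _) ⟩
        window w (cut j) r ++ window w i n ++ window w (i + n) (L ∸ r ∸ n) ∎
      where open ≡-Reasoning

_⇒ᵇ_ : Bool → Bool → Bool
false ⇒ᵇ _ = true
true  ⇒ᵇ y = y

⇒ᵇ-mp : ∀ {x y} → T (x ⇒ᵇ y) → T x → T y
⇒ᵇ-mp {true} y _ = y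

-- Finite checks are stated as b ≡ true and proved by refl (Agda evaluates these faster than T b).
certified : ∀ {b} → b ≡ true → T b
certified refl = _

∧-split : ∀ {x y} → T (x ∧ y) → T x × T y
∧-split = Equivalence.to T-∧

check-all : {A : Set} (p : A → Bool) (xs : List A) {y : A} → all p xs ≡ true → y ∈ xs → T (p y)
check-all p xs ok = All.lookup (all⁺ p xs (certified ok))

range : ℕ → ℕ → List ℕ
range lo n = applyUpTo (lo +_) n

check-range : (p : ℕ → Bool) (lo n : ℕ) → T (all p (range lo n)) → ∀ k → k < n → T (p (lo + k))
check-range p lo n ok k k<n = applyUpTo⁻ (lo +_) n (all⁺ p (range lo n) ok) k<n

module Letters {X : Set} (code : X → ℕ) (decode : ℕ → X) (decode-code : ∀ x → decode (code x) ≡ x) where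

  _==_ : X → X → Bool
  x == y = code x ≡ᵇ code y

  ==-sound : ∀ x y → T (x == y) → x ≡ y
  ==-sound x y eq = trans (sym (decode-code x)) (trans (cong decode (≡ᵇ⇒≡ (code x) (code y) eq)) (decode-code y))

  _==ₘ_ : Maybe X → Maybe X → Bool
  just x  ==ₘ just y  = x == y
  nothing ==ₘ nothing = true
  _       ==ₘ _       = false

  ==ₘ-sound : ∀ m m′ → T (m ==ₘ m′) → m ≡ m′
  ==ₘ-sound (just x) (just y) eq = cong just (==-sound x y eq)
  ==ₘ-sound nothing  nothing  _  = refl

  _==ₗ_ : List X → List X → Bool
  []      ==ₗ []      = true
  (x ∷ u) ==ₗ (y ∷ v) = (x == y) ∧ (u ==ₗ v)
  _       ==ₗ _       = false

  ==ₗ-sound : ∀ u v → T (u ==ₗ v) → u ≡ v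
  ==ₗ-sound []      []      _  = refl
  ==ₗ-sound (x ∷ u) (y ∷ v) eq with ∧-split {x == y} eq
  ... | x≡y , u≡v = cong₂ _∷_ (==-sound x y x≡y) (==ₗ-sound u v u≡v)

  _∈ᵇ_ : List X → List (List X) → Bool
  u ∈ᵇ F = any (u ==ₗ_) F

  ∈ᵇ-sound : ∀ u F → T (u ∈ᵇ F) → u ∈ F
  ∈ᵇ-sound u F u∈F = Any.map (==ₗ-sound u _) (any⁻ (u ==ₗ_) F u∈F)

  commonPrefix : List X → List X → ℕ
  commonPrefix (x ∷ σ) (y ∷ δ) = if x == y then suc (commonPrefix σ δ) else 0
  commonPrefix _       _       = 0

  commonPrefix-≥ : (x₀ : X) (P : ℕ) (σ δ : List X) → P ≤ length σ → P ≤ length δ →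
                   (∀ t → t < P → lookupD x₀ σ t ≡ lookupD x₀ δ t) → P ≤ commonPrefix σ δ
  commonPrefix-≥ x₀ zero    σ       δ       _         _         _  = z≤n
  commonPrefix-≥ x₀ (suc P) (x ∷ σ) (y ∷ δ) (s≤s P≤σ) (s≤s P≤δ) eq with eq 0 z<s
  ... | refl with x == x | ≡⇒≡ᵇ (code x) (code x) refl
  ...   | true | _ = s≤s (commonPrefix-≥ x₀ P σ δ P≤σ P≤δ (λ t t<P → eq (suc t) (s<s t<P)))

  allSuffixes : (List X → List X → Bool) → List X → List X → Bool
  allSuffixes p []      δ = true
  allSuffixes p (x ∷ σ) δ = p (x ∷ σ) δ ∧ allSuffixes p σ (drop 1 δ)

  allSuffixes-sound : ∀ p σ δ → T (allSuffixes p σ δ) → ∀ k → k < length σ → T (p (drop k σ) (drop k δ))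
  allSuffixes-sound p (x ∷ σ) δ ok zero    _         = proj₁ (∧-split ok)
  allSuffixes-sound p (x ∷ σ) δ ok (suc k) (s≤s k<σ) =
    subst (λ δ′ → T (p (drop k σ) δ′)) (drop-drop 1 k δ)
          (allSuffixes-sound p σ (drop 1 δ) (proj₂ (∧-split {p (x ∷ σ) δ} ok)) k k<σ)

  repetition⇒commonPrefix : (x₀ : X) (w : ℕ → X) (i n p P : ℕ) (s : List X) (I : Infix (window w i n) s) →
    P + p ≤ n → Repetition w i p P → P ≤ commonPrefix (drop (offset I) s) (drop (offset I) (drop p s))
  repetition⇒commonPrefix x₀ w i n p P s I P+p≤n rep =
    commonPrefix-≥ x₀ P (drop k s) (drop k (drop p s)) P≤σ P≤δ agree
    where
    k = offset I
    k+n≤s : k + n ≤ length s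
    k+n≤s = subst (λ m → k + m ≤ length s) (length-window w i n) (infix-length I)
    P≤n : P ≤ n
    P≤n = ≤-trans (m≤m+n P p) P+p≤n
    P+k≤s : P + k ≤ length s
    P+k≤s = ≤-trans (subst (_≤ k + n) (+-comm k P) (+-monoʳ-≤ k P≤n)) k+n≤s
    P≤σ : P ≤ length (drop k s)
    P≤σ = subst (P ≤_) (sym (length-drop k s)) (m+n≤o⇒m≤o∸n P P+k≤s)
    P≤δ : P ≤ length (drop k (drop p s))
    P≤δ = subst (P ≤_) (sym (trans (length-drop k (drop p s)) (cong (_∸ k) (length-drop p s))))
      (m+n≤o⇒m≤o∸n P (m+n≤o⇒m≤o∸n (P + k)
        (≤-trans (≤-reflexive (rearrange P k p)) (≤-trans (+-monoʳ-≤ k P+p≤n) k+n≤s))))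
      where
      rearrange : ∀ P k p → P + k + p ≡ k + (P + p)
      rearrange = solve-∀
    agree : ∀ t → t < P → lookupD x₀ (drop k s) t ≡ lookupD x₀ (drop k (drop p s)) t
    agree t t<P = begin
        lookupD x₀ (drop k s) t                ≡⟨ lookup-drop x₀ s k t ⟩
        lookupD x₀ s (k + t)                   ≡⟨ infix-lookup x₀ I t (subst (t <_) (sym (length-window w i n)) t<n) ⟩
        lookupD x₀ (window w i n) t            ≡⟨ lookup-window x₀ w i n t t<n ⟩
        w (i + t)                              ≡⟨ rep t t<P ⟩
        w (i + t + p)                          ≡⟨ cong w (+-assoc i t p) ⟩
        w (i + (t + p))                        ≡⟨ lookup-window x₀ w i n (t + p) t+p<n ⟨
        lookupD x₀ (window w i n) (t + p)      ≡⟨ infix-lookup x₀ I (t + p) (subst (t + p <_) (sym (length-window w i n)) t+p<n) ⟨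
        lookupD x₀ s (k + (t + p))             ≡⟨ cong (lookupD x₀ s) (trans (sym (+-assoc k t p)) (+-comm (k + t) p)) ⟩
        lookupD x₀ s (p + (k + t))             ≡⟨ lookup-drop x₀ s p (k + t) ⟨
        lookupD x₀ (drop p s) (k + t)          ≡⟨ lookup-drop x₀ (drop p s) k t ⟨
        lookupD x₀ (drop k (drop p s)) t       ∎
      where
      open ≡-Reasoning
      t<n : t < n
      t<n = <-≤-trans t<P P≤n
      t+p<n : t + p < n
      t+p<n = <-≤-trans (+-monoˡ-< p t<P) P+p≤n

code₆ : A6 → ℕ
code₆ a = 0
code₆ b = 1
code₆ c = 2
code₆ d = 3
code₆ e = 4
code₆ f = 5

decode₆ : ℕ → A6
decode₆ 0 = a
decode₆ 1 = b
decode₆ 2 = c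
decode₆ 3 = d
decode₆ 4 = e
decode₆ _ = f

decode-code₆ : ∀ x → decode₆ (code₆ x) ≡ x
decode-code₆ a = refl
decode-code₆ b = refl
decode-code₆ c = refl
decode-code₆ d = refl
decode-code₆ e = refl
decode-code₆ f = refl

code₂ : Bit → ℕ
code₂ b0 = 0
code₂ b1 = 1

decode₂ : ℕ → Bit
decode₂ 0 = b0
decode₂ _ = b1

decode-code₂ : ∀ x → decode₂ (code₂ x) ≡ x
decode-code₂ b0 = refl
decode-code₂ b1 = refl

module L₆ = Letters code₆ decode₆ decode-code₆
module L₂ = Letters code₂ decode₂ decode-code₂

module Gimage = Image g g-≥4 g-≤5 gInf gInf gInf-image
module Himage = Image h h-≥4 h-≤5 gInf hInf hInf-image

image-factor : ℕ → List A6 → ℕ → List A6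
image-factor n v r = take n (drop r (morph g (take 3 v)))

closed-at : ℕ → List (List A6) → List A6 → Bool
closed-at n F v = all (λ r → image-factor n v r L₆.∈ᵇ F) (range 0 5)

closed-under-g : ℕ → List (List A6) → Bool
closed-under-g n F = all (closed-at n F) F

-- If F is closed under g and contains the prefix of length n of g^∞(a), it contains all its
-- factors of length n (3 ≤ n ≤ 8): each one lies inside g of an earlier length-3 factor.
factors-closed : (n : ℕ) (F : List (List A6)) → 3 ≤ n → n + 4 ≤ 12 → closed-under-g n F ≡ true →
                 window gInf 0 n ∈ F → ∀ i → window gInf i n ∈ F
factors-closed n F 3≤n n+4≤12 closed first = <-rec (λ i → window gInf i n ∈ F) step
  where
  from-earlier : ∀ i → (∀ {m} → m < suc i → window gInf m n ∈ F) →
    Σ ℕ (λ j → 4 * j ≤ suc i × Σ (Infix (window gInf (suc i) n) (Gimage.block j 3)) λ I → offset I ≤ 4) →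
    window gInf (suc i) n ∈ F
  from-earlier i IH (j , 4j≤i+1 , I , offset≤4) =
    subst (_∈ F) extract (L₆.∈ᵇ-sound (image-factor n v (offset I)) F found)
    where
    v = window gInf j n
    j<i+1 : j < suc i
    j<i+1 = quarter j 4j≤i+1
      where
      quarter : ∀ j → 4 * j ≤ suc i → j < suc i
      quarter zero    _     = z<s
      quarter (suc j) 4j≤i+1 = <-≤-trans (subst (suc j <_) (*-comm (suc j) 4) (m<m*n (suc j) 4 (s≤s (s≤s z≤n)))) 4j≤i+1
    found : T (image-factor n v (offset I) L₆.∈ᵇ F)
    found = check-range (λ r → image-factor n v r L₆.∈ᵇ F) 0 5
              (check-all (closed-at n F) F closed (IH j<i+1))
              (offset I) (s≤s offset≤4)
    extract : image-factor n v (offset I) ≡ window gInf (suc i) n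
    extract = begin
        take n (drop (offset I) (morph g (take 3 v)))
      ≡⟨ cong (λ u → take n (drop (offset I) (morph g u))) (take-window gInf j 3 n 3≤n) ⟩
        take n (drop (offset I) (morph g (window gInf j 3)))
      ≡⟨ cong (λ m → take m _) (length-window gInf (suc i) n) ⟨
        take (length (window gInf (suc i) n)) (drop (offset I) (morph g (window gInf j 3)))
      ≡⟨ infix-take-drop I ⟩
        window gInf (suc i) n ∎
      where open ≡-Reasoning
  step : ∀ i → (∀ {m} → m < i → window gInf m n ∈ F) → window gInf i n ∈ F
  step zero    _  = first
  step (suc i) IH = from-earlier i IH (Gimage.window-in-block (suc i) n 3 n+4≤12)

factors₄ : List (List A6)
factors₄ =
  (a ∷ b ∷ a ∷ c ∷ []) ∷ (a ∷ b ∷ d ∷ a ∷ []) ∷ (a ∷ b ∷ d ∷ f ∷ []) ∷ (a ∷ c ∷ b ∷ a ∷ []) ∷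
  (a ∷ c ∷ e ∷ a ∷ []) ∷ (b ∷ a ∷ b ∷ d ∷ []) ∷ (b ∷ a ∷ c ∷ b ∷ []) ∷ (b ∷ a ∷ c ∷ e ∷ []) ∷
  (b ∷ d ∷ a ∷ b ∷ []) ∷ (b ∷ d ∷ f ∷ b ∷ []) ∷ (c ∷ b ∷ a ∷ b ∷ []) ∷ (c ∷ e ∷ a ∷ b ∷ []) ∷
  (d ∷ a ∷ b ∷ a ∷ []) ∷ (d ∷ f ∷ b ∷ a ∷ []) ∷ (e ∷ a ∷ b ∷ a ∷ []) ∷ (e ∷ a ∷ b ∷ d ∷ []) ∷
  (f ∷ b ∷ a ∷ b ∷ []) ∷ (f ∷ b ∷ a ∷ c ∷ []) ∷ []

factors₅ : List (List A6)
factors₅ =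
  (a ∷ b ∷ a ∷ c ∷ b ∷ []) ∷ (a ∷ b ∷ a ∷ c ∷ e ∷ []) ∷ (a ∷ b ∷ d ∷ a ∷ b ∷ []) ∷ (a ∷ b ∷ d ∷ f ∷ b ∷ []) ∷
  (a ∷ c ∷ b ∷ a ∷ b ∷ []) ∷ (a ∷ c ∷ e ∷ a ∷ b ∷ []) ∷ (b ∷ a ∷ b ∷ d ∷ a ∷ []) ∷ (b ∷ a ∷ b ∷ d ∷ f ∷ []) ∷
  (b ∷ a ∷ c ∷ b ∷ a ∷ []) ∷ (b ∷ a ∷ c ∷ e ∷ a ∷ []) ∷ (b ∷ d ∷ a ∷ b ∷ a ∷ []) ∷ (b ∷ d ∷ f ∷ b ∷ a ∷ []) ∷
  (c ∷ b ∷ a ∷ b ∷ d ∷ []) ∷ (c ∷ e ∷ a ∷ b ∷ a ∷ []) ∷ (c ∷ e ∷ a ∷ b ∷ d ∷ []) ∷ (d ∷ a ∷ b ∷ a ∷ c ∷ []) ∷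
  (d ∷ f ∷ b ∷ a ∷ b ∷ []) ∷ (d ∷ f ∷ b ∷ a ∷ c ∷ []) ∷ (e ∷ a ∷ b ∷ a ∷ c ∷ []) ∷ (e ∷ a ∷ b ∷ d ∷ f ∷ []) ∷
  (f ∷ b ∷ a ∷ b ∷ d ∷ []) ∷ (f ∷ b ∷ a ∷ c ∷ e ∷ []) ∷ []

factor₄ : ∀ i → window gInf i 4 ∈ factors₄
factor₄ = factors-closed 4 factors₄ (≤ᵇ⇒≤ 3 4 tt) (≤ᵇ⇒≤ 8 12 tt) refl (L₆.∈ᵇ-sound _ factors₄ (certified refl))

factor₅ : ∀ i → window gInf i 5 ∈ factors₅
factor₅ = factors-closed 5 factors₅ (≤ᵇ⇒≤ 3 5 tt) (≤ᵇ⇒≤ 9 12 tt) refl (L₆.∈ᵇ-sound _ factors₅ (certified refl))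

expected : ℕ → A6 → Maybe A6
expected zero    y = just y
expected (suc _) _ = nothing

-- The decoder recognises the position at offset s inside φ(y), when the window of length 5 + R
-- starting 5 positions earlier lies inside φ(v) (L is the length of the image before y).
decodes-at : {Y : Set} → (A6 → List Y) → ℕ → (List Y → Maybe A6) → List A6 → A6 → ℕ → ℕ → Bool
decodes-at φ R dec v y L s =
  (s <ᵇ length (φ y)) ⇒ᵇ ((5 ≤ᵇ L + s) ⇒ᵇ (dec (take (5 + R) (drop (L + s ∸ 5) (morph φ v))) L₆.==ₘ expected s y))

decodes-letter : {Y : Set} → (A6 → List Y) → ℕ → (List Y → Maybe A6) → List A6 → ℕ → ℕ → Bool
decodes-letter φ R dec v t = decodes-at φ R dec v (lookupD a v t) (length (morph φ (take t v)))

decodes-factor : {Y : Set} → (A6 → List Y) → ℕ → (List Y → Maybe A6) → List A6 → Bool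
decodes-factor φ R dec v = all (λ t → all (decodes-letter φ R dec v t) (range 0 5)) (range 1 2)

decodes-cuts : {Y : Set} → (A6 → List Y) → ℕ → (List Y → Maybe A6) → List (List A6) → Bool
decodes-cuts φ R dec F = all (decodes-factor φ R dec) F

-- Synchronisation: if the decoder passes the check, a window of length 5 + R of w = φ(x) determines
-- whether its sixth position is a cut and which letter starts there.
module Synchronisation {Y : Set} (φ : A6 → List Y) (φ-≥4 : ∀ x → 4 ≤ length (φ x)) (φ-≤5 : ∀ x → length (φ x) ≤ 5)
  (x : ℕ → A6) (w : ℕ → Y) (w-image : IsImage φ x w) (F : List (List A6)) (factor : ∀ j → window x j 4 ∈ F)
  (R : ℕ) (R≤5 : R ≤ 5) (dec : List Y → Maybe A6) (dec-ok : decodes-cuts φ R dec F ≡ true) where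

  open Image φ φ-≥4 φ-≤5 x w w-image public

  decode-inside : ∀ j₀ t s → 1 ≤ t → t ≤ 2 → s < length (φ (x (j₀ + t))) → 5 ≤ length (block j₀ t) + s →
    dec (window w (cut j₀ + (length (block j₀ t) + s ∸ 5)) (5 + R)) ≡ expected s (x (j₀ + t))
  decode-inside j₀ (suc t′) s (s≤s z≤n) t≤2 s<φ 5≤L+s =
    trans (cong dec (sym window≡)) (L₆.==ₘ-sound _ _ (⇒ᵇ-mp (⇒ᵇ-mp checked (<⇒<ᵇ s<φ)) (≤⇒≤ᵇ 5≤L+s)))
    where
    t = suc t′
    v = window x j₀ 4
    L = length (block j₀ t)
    t<4 : t < 4
    t<4 = s≤s (≤-trans t≤2 (≤ᵇ⇒≤ 2 3 tt))
    checked : T (decodes-at φ R dec v (x (j₀ + t)) L s)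
    checked = subst₂ (λ y L → T (decodes-at φ R dec v y L s))
      (lookup-window a x j₀ 4 t t<4) (cong (λ u → length (morph φ u)) (take-window x j₀ t 4 (<⇒≤ t<4)))
      (check-range (decodes-letter φ R dec v t) 0 5
        (check-range (λ t → all (decodes-letter φ R dec v t) (range 0 5)) 1 2
                     (check-all (decodes-factor φ R dec) F dec-ok (factor j₀)) t′ t≤2)
        s (<-≤-trans s<φ (φ-≤5 _)))
    bound : L + s ∸ 5 + (5 + R) ≤ length (block j₀ 4)
    bound = begin
        L + s ∸ 5 + (5 + R)                                     ≡⟨ +-assoc (L + s ∸ 5) 5 R ⟨
        L + s ∸ 5 + 5 + R                                       ≡⟨ cong (_+ R) (m∸n+n≡m 5≤L+s) ⟩
        L + s + R                                               ≤⟨ +-monoʳ-≤ (L + s) R≤5 ⟩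
        L + s + 5                                               ≡⟨ trans (+-assoc L s 5) (cong (L +_) (+-suc s 4)) ⟩
        L + (suc s + 4)                                         ≤⟨ +-monoʳ-≤ L (+-monoˡ-≤ 4 s<φ) ⟩
        L + (length (φ (x (j₀ + t))) + 4)                       ≡⟨ +-assoc L _ 4 ⟨
        L + length (φ (x (j₀ + t))) + 4                         ≡⟨ cong (_+ 4) (length-block-suc j₀ t) ⟨
        length (block j₀ (suc t)) + 4                           ≤⟨ +-monoʳ-≤ _ (φ-≥4 _) ⟩
        length (block j₀ (suc t)) + length (φ (x (j₀ + suc t))) ≡⟨ length-block-suc j₀ (suc t) ⟨
        length (block j₀ (suc (suc t)))                         ≤⟨ length-block-mono j₀ (s≤s (s≤s t≤2)) ⟩
        length (block j₀ 4)                                     ∎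
      where open ≤-Reasoning
    window≡ : take (5 + R) (drop (L + s ∸ 5) (morph φ v)) ≡ window w (cut j₀ + (L + s ∸ 5)) (5 + R)
    window≡ = trans (cong (λ u → take (5 + R) (drop (L + s ∸ 5) u)) (sym (window-at-cut j₀ 4)))
                    (take-drop-window w (cut j₀) (L + s ∸ 5) (5 + R) (length (block j₀ 4)) bound)

  decode-position : ∀ j s → s < length (φ (x j)) → 5 ≤ cut j + s →
    dec (window w (cut j + s ∸ 5) (5 + R)) ≡ expected s (x j)
  decode-position zero            s s<φ 5≤s   = ⊥-elim (<⇒≱ (<-≤-trans s<φ (φ-≤5 _)) 5≤s)
  decode-position (suc zero)      s s<φ 5≤c+s = decode-inside 0 1 s ≤-refl (s≤s z≤n) s<φ 5≤c+s
  decode-position (suc (suc j₂)) s s<φ 5≤c+s =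
    subst₂ (λ p y → dec (window w p (5 + R)) ≡ expected s y) position≡ (cong x j₂+2≡)
      (decode-inside j₂ 2 s (s≤s z≤n) ≤-refl (subst (λ j → s < length (φ (x j))) (sym j₂+2≡) s<φ) 5≤L+s)
    where
    j₂+2≡ : j₂ + 2 ≡ suc (suc j₂)
    j₂+2≡ = +-comm j₂ 2
    5≤L+s : 5 ≤ length (block j₂ 2) + s
    5≤L+s = ≤-trans (≤ᵇ⇒≤ 5 8 tt) (≤-trans (length-block-≥ j₂ 2) (m≤m+n _ s))
    position≡ : cut j₂ + (length (block j₂ 2) + s ∸ 5) ≡ cut (suc (suc j₂)) + s ∸ 5
    position≡ = begin
        cut j₂ + (length (block j₂ 2) + s ∸ 5) ≡⟨ +-∸-assoc (cut j₂) 5≤L+s ⟨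
        cut j₂ + (length (block j₂ 2) + s) ∸ 5 ≡⟨ cong (_∸ 5) (+-assoc (cut j₂) _ s) ⟨
        cut j₂ + length (block j₂ 2) + s ∸ 5   ≡⟨ cong (λ m → m + s ∸ 5) (trans (sym (cut-+ j₂ 2)) (cong cut j₂+2≡)) ⟩
        cut (suc (suc j₂)) + s ∸ 5             ∎
      where open ≡-Reasoning

  synchronise : ∀ j j′ s → s < length (φ (x j′)) → 5 ≤ cut j → 5 ≤ cut j′ + s →
    window w (cut j ∸ 5) (5 + R) ≡ window w (cut j′ + s ∸ 5) (5 + R) → s ≡ 0 × x j ≡ x j′
  synchronise j j′ s s<φ 5≤c 5≤c′+s same = letters s (begin
      just (x j)                                 ≡⟨ decode-position j 0 (<-≤-trans z<s (φ-≥4 _)) 5≤c+0 ⟨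
      dec (window w (cut j + 0 ∸ 5) (5 + R))     ≡⟨ cong (λ m → dec (window w (m ∸ 5) (5 + R))) (+-identityʳ (cut j)) ⟩
      dec (window w (cut j ∸ 5) (5 + R))         ≡⟨ cong dec same ⟩
      dec (window w (cut j′ + s ∸ 5) (5 + R))    ≡⟨ decode-position j′ s s<φ 5≤c′+s ⟩
      expected s (x j′)                          ∎)
    where
    open ≡-Reasoning
    5≤c+0 : 5 ≤ cut j + 0
    5≤c+0 = subst (5 ≤_) (sym (+-identityʳ (cut j))) 5≤c
    letters : ∀ s → just (x j) ≡ expected s (x j′) → s ≡ 0 × x j ≡ x j′
    letters zero eq = refl , just-injective eq

-- Decoders given by finite tables of the windows that announce a cut (all other windows do not).
look-up : {Y : Set} → (List Y → List Y → Bool) → List (List Y × A6) → List Y → Maybe A6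
look-up _==_ []                u = nothing
look-up _==_ ((k , y) ∷ table) u = if u == k then just y else look-up _==_ table u

cut-table-g : List (List A6 × A6)
cut-table-g =
  ((c ∷ b ∷ a ∷ b ∷ d ∷ a ∷ b ∷ a ∷ []) , a) ∷
  ((c ∷ b ∷ a ∷ b ∷ d ∷ f ∷ b ∷ a ∷ []) , d) ∷
  ((e ∷ a ∷ b ∷ d ∷ f ∷ b ∷ a ∷ b ∷ []) , b) ∷
  ((e ∷ a ∷ b ∷ d ∷ f ∷ b ∷ a ∷ c ∷ []) , e) ∷
  ((d ∷ a ∷ b ∷ a ∷ c ∷ b ∷ a ∷ b ∷ []) , b) ∷
  ((d ∷ a ∷ b ∷ a ∷ c ∷ e ∷ a ∷ b ∷ []) , c) ∷
  ((f ∷ b ∷ a ∷ c ∷ e ∷ a ∷ b ∷ a ∷ []) , a) ∷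
  ((f ∷ b ∷ a ∷ c ∷ e ∷ a ∷ b ∷ d ∷ []) , f) ∷
  ((f ∷ b ∷ a ∷ b ∷ d ∷ a ∷ b ∷ a ∷ []) , a) ∷
  ((e ∷ a ∷ b ∷ a ∷ c ∷ b ∷ a ∷ b ∷ []) , b) ∷
  []

cut-table-h : List (List Bit × A6)
cut-table-h =
  ((b1 ∷ b0 ∷ b0 ∷ b1 ∷ b1 ∷ b0 ∷ b1 ∷ b1 ∷ b0 ∷ b0 ∷ []) , b) ∷
  ((b0 ∷ b1 ∷ b1 ∷ b0 ∷ b0 ∷ b1 ∷ b0 ∷ b0 ∷ b1 ∷ b1 ∷ []) , a) ∷
  ((b0 ∷ b1 ∷ b1 ∷ b0 ∷ b0 ∷ b1 ∷ b0 ∷ b1 ∷ b1 ∷ b0 ∷ []) , d) ∷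
  ((b1 ∷ b0 ∷ b0 ∷ b1 ∷ b1 ∷ b0 ∷ b1 ∷ b0 ∷ b0 ∷ b1 ∷ []) , c) ∷
  ((b0 ∷ b1 ∷ b0 ∷ b0 ∷ b1 ∷ b0 ∷ b1 ∷ b1 ∷ b0 ∷ b0 ∷ []) , b) ∷
  ((b0 ∷ b1 ∷ b0 ∷ b0 ∷ b1 ∷ b0 ∷ b1 ∷ b1 ∷ b0 ∷ b1 ∷ []) , e) ∷
  ((b1 ∷ b0 ∷ b1 ∷ b1 ∷ b0 ∷ b1 ∷ b0 ∷ b0 ∷ b1 ∷ b1 ∷ []) , a) ∷
  ((b1 ∷ b0 ∷ b1 ∷ b1 ∷ b0 ∷ b1 ∷ b0 ∷ b0 ∷ b1 ∷ b0 ∷ []) , f) ∷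
  []

decode-g : List A6 → Maybe A6
decode-g = look-up L₆._==ₗ_ cut-table-g

decode-h : List Bit → Maybe A6
decode-h = look-up L₂._==ₗ_ cut-table-h

g-decodes-cuts : decodes-cuts g 3 decode-g factors₄ ≡ true
g-decodes-cuts = refl

h-decodes-cuts : decodes-cuts h 5 decode-h factors₄ ≡ true
h-decodes-cuts = refl

-- Desubstitution: a long repetition of period p in w = φ(x) comes from a repetition of period q
-- in x with 4q ≤ p ≤ 5q: the cuts inside the repetition are translated by p to cuts of the same letters.
module Desubstitution {Y : Set} (φ : A6 → List Y) (φ-≥4 : ∀ x → 4 ≤ length (φ x)) (φ-≤5 : ∀ x → length (φ x) ≤ 5)
  (x : ℕ → A6) (w : ℕ → Y) (w-image : IsImage φ x w) (F : List (List A6)) (factor : ∀ j → window x j 4 ∈ F)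
  (R : ℕ) (R≤5 : R ≤ 5) (dec : List Y → Maybe A6) (dec-ok : decodes-cuts φ R dec F ≡ true) where

  open Synchronisation φ φ-≥4 φ-≤5 x w w-image F factor R R≤5 dec dec-ok

  module _ {i p P : ℕ} (1≤p : 1 ≤ p) (9+R≤P : 9 + R ≤ P) (p+R≤P+7 : p + R ≤ P + 7) (rep : Repetition w i p P) where

    window-shift : ∀ m → i + 5 ≤ m → m + R ≤ i + P → window w (m ∸ 5) (5 + R) ≡ window w (m + p ∸ 5) (5 + R)
    window-shift m i+5≤m m+R≤i+P =
      trans (repetition-window rep (m ∸ 5) (5 + R) (m+n≤o⇒m≤o∸n i i+5≤m) inside)
            (cong (λ s → window w s (5 + R)) shift)
      where
      5≤m : 5 ≤ m
      5≤m = ≤-trans (m≤n+m 5 i) i+5≤m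
      inside : m ∸ 5 + (5 + R) ≤ i + P
      inside = subst (_≤ i + P) (trans (cong (_+ R) (sym (m∸n+n≡m 5≤m))) (+-assoc (m ∸ 5) 5 R)) m+R≤i+P
      shift : m ∸ 5 + p ≡ m + p ∸ 5
      shift = trans (+-comm (m ∸ 5) p) (trans (sym (+-∸-assoc p 5≤m)) (cong (_∸ 5) (+-comm p m)))

    matched-cuts : ∀ k k′ → cut k′ ≡ cut k + p → i + 5 ≤ cut k → cut k + R ≤ i + P → x k ≡ x k′
    matched-cuts k k′ k′≡ i+5≤c c+R≤i+P = proj₂ (synchronise k k′ 0 (<-≤-trans z<s (φ-≥4 _)) 5≤c 5≤c′ same)
      where
      c′≡ : cut k′ + 0 ≡ cut k + p
      c′≡ = trans (+-identityʳ _) k′≡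
      5≤c : 5 ≤ cut k
      5≤c = ≤-trans (m≤n+m 5 i) i+5≤c
      5≤c′ : 5 ≤ cut k′ + 0
      5≤c′ = subst (5 ≤_) (sym c′≡) (≤-trans 5≤c (m≤m+n _ p))
      same : window w (cut k ∸ 5) (5 + R) ≡ window w (cut k′ + 0 ∸ 5) (5 + R)
      same = trans (window-shift (cut k) i+5≤c c+R≤i+P) (cong (λ m → window w (m ∸ 5) (5 + R)) (sym c′≡))

    first-cut : Σ ℕ λ j → i + 5 ≤ cut j × cut j ≤ i + 9
    first-cut with locate (i + 5)
    ... | j , cj≤i+5 , i+5<cj+1 with m≤n⇒m<n∨m≡n cj≤i+5
    ...   | inj₂ cj≡i+5 = j , ≤-reflexive (sym cj≡i+5) , subst (_≤ i + 9) (sym cj≡i+5) (+-monoʳ-≤ i (≤ᵇ⇒≤ 5 9 tt))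
    ...   | inj₁ cj<i+5 = suc j , <⇒≤ i+5<cj+1 , (begin
        cut (suc j) ≤⟨ cut-suc-≤ j ⟩
        cut j + 5   ≤⟨ +-monoˡ-≤ 5 (≤-pred (subst (cut j <_) (+-suc i 4) cj<i+5)) ⟩
        i + 4 + 5   ≡⟨ +-assoc i 4 5 ⟩
        i + 9       ∎)
      where open ≤-Reasoning

    partner-cut : ∀ j → i + 5 ≤ cut j → cut j ≤ i + 9 → Σ ℕ λ j′ → cut j′ ≡ cut j + p × x j ≡ x j′
    partner-cut j i+5≤c c≤i+9 with locate (cut j + p)
    ... | j′ , c′≤ , <c′+1 = j′ , trans (sym (+-identityʳ (cut j′))) (trans (cong (cut j′ +_) (sym (proj₁ synced))) c′+s≡) , proj₂ synced
      where
      s = cut j + p ∸ cut j′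
      c′+s≡ : cut j′ + s ≡ cut j + p
      c′+s≡ = m+[n∸m]≡n c′≤
      s<φ : s < length (φ (x j′))
      s<φ = +-cancelˡ-< (cut j′) _ _ (subst₂ _<_ (sym c′+s≡) (cut-suc j′) <c′+1)
      5≤c : 5 ≤ cut j
      5≤c = ≤-trans (m≤n+m 5 i) i+5≤c
      c+R≤i+P : cut j + R ≤ i + P
      c+R≤i+P = ≤-trans (+-monoˡ-≤ R c≤i+9) (subst (_≤ i + P) (sym (+-assoc i 9 R)) (+-monoʳ-≤ i 9+R≤P))
      synced : s ≡ 0 × x j ≡ x j′
      synced = synchronise j j′ s s<φ 5≤c (subst (5 ≤_) (sym c′+s≡) (≤-trans 5≤c (m≤m+n _ p)))
        (trans (window-shift (cut j) i+5≤c c+R≤i+P) (cong (λ m → window w (m ∸ 5) (5 + R)) (sym c′+s≡)))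

    shifted-cuts : ∀ j j′ → i + 5 ≤ cut j → cut j′ ≡ cut j + p → x j ≡ x j′ →
                   ∀ t → cut (j + t) + R ≤ i + P → cut (j′ + t) ≡ cut (j + t) + p × x (j + t) ≡ x (j′ + t)
    shifted-cuts j j′ i+5≤c c′≡ x≡ zero _ =
      subst₂ (λ k k′ → cut k′ ≡ cut k + p × x k ≡ x k′) (sym (+-identityʳ j)) (sym (+-identityʳ j′)) (c′≡ , x≡)
    shifted-cuts j j′ i+5≤c c′≡ x≡ (suc t) bound = cut≡ , matched-cuts (j + suc t) (j′ + suc t) cut≡ i+5≤c+t+1 bound
      where
      i+5≤c+t+1 : i + 5 ≤ cut (j + suc t)
      i+5≤c+t+1 = ≤-trans i+5≤c (cut-mono-≤ (m≤m+n j (suc t)))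
      previous : cut (j′ + t) ≡ cut (j + t) + p × x (j + t) ≡ x (j′ + t)
      previous = shifted-cuts j j′ i+5≤c c′≡ x≡ t
        (≤-trans (+-monoˡ-≤ R (cut-mono-≤ (+-monoʳ-≤ j (n≤1+n t)))) bound)
      cut≡ : cut (j′ + suc t) ≡ cut (j + suc t) + p
      cut≡ = begin
          cut (j′ + suc t)                            ≡⟨ cong cut (+-suc j′ t) ⟩
          cut (suc (j′ + t))                          ≡⟨ cut-suc (j′ + t) ⟩
          cut (j′ + t) + length (φ (x (j′ + t)))      ≡⟨ cong₂ (λ m y → m + length (φ y)) (proj₁ previous) (sym (proj₂ previous)) ⟩
          cut (j + t) + p + length (φ (x (j + t)))    ≡⟨ +-swapʳ (cut (j + t)) p _ ⟩
          cut (j + t) + length (φ (x (j + t))) + p    ≡⟨ cong (_+ p) (cut-suc (j + t)) ⟨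
          cut (suc (j + t)) + p                       ≡⟨ cong (λ k → cut k + p) (+-suc j t) ⟨
          cut (j + suc t) + p                         ∎
        where
        open ≡-Reasoning
        +-swapʳ : ∀ m n o → m + n + o ≡ m + o + n
        +-swapʳ = solve-∀

    repetition-from-cuts : ∀ j j′ → i + 5 ≤ cut j → cut j ≤ i + 9 → cut j′ ≡ cut j + p → x j ≡ x j′ →
                           Σ ℕ λ q → 4 * q ≤ p × p ≤ 5 * q × Repetition x j q (q ∸ 3)
    repetition-from-cuts j j′ i+5≤c c≤i+9 c′≡ x≡ = q , 4q≤p , p≤5q , repeats
      where
      j<j′ : j < j′
      j<j′ = ≰⇒> (λ j′≤j → <⇒≱ (subst (cut j <_) (sym c′≡) (m<m+n (cut j) 1≤p)) (cut-mono-≤ j′≤j))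
      q = j′ ∸ j
      j+q≡j′ : j + q ≡ j′
      j+q≡j′ = m+[n∸m]≡n (<⇒≤ j<j′)
      cq≡ : cut (j + q) ≡ cut j + p
      cq≡ = trans (cong cut j+q≡j′) c′≡
      4q≤p : 4 * q ≤ p
      4q≤p = +-cancelˡ-≤ (cut j) _ _ (subst (cut j + 4 * q ≤_) cq≡ (cut-+-≥ j q))
      p≤5q : p ≤ 5 * q
      p≤5q = +-cancelˡ-≤ (cut j) _ _ (subst (_≤ cut j + 5 * q) cq≡ (cut-+-≤ j q))
      repeats : Repetition x j q (q ∸ 3)
      repeats t t<q∸3 = trans (proj₂ (shifted-cuts j j′ i+5≤c c′≡ x≡ t bound))
                              (cong x (trans (cong (_+ t) (sym j+q≡j′)) (+-swapʳ j q t)))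
        where
        +-swapʳ : ∀ m n o → m + n + o ≡ m + o + n
        +-swapʳ = solve-∀
        3≤q : 3 ≤ q
        3≤q = ≮⇒≥ (λ q<3 → <⇒≱ t<q∸3 (subst (_≤ t) (sym (m≤n⇒m∸n≡0 (<⇒≤ q<3))) z≤n))
        t+4≤q : t + 4 ≤ q
        t+4≤q = subst (_≤ q) (sym (+-suc t 3)) (m≤o∸n⇒m+n≤o (suc t) 3≤q t<q∸3)
        16≤ : cut (j + t) + 16 ≤ cut (j + q)
        16≤ = begin
            cut (j + t) + 4 * 4        ≤⟨ +-monoʳ-≤ (cut (j + t)) (*-monoʳ-≤ 4 (m+n≤o⇒m≤o∸n 4 (subst (_≤ q) (+-comm t 4) t+4≤q))) ⟩
            cut (j + t) + 4 * (q ∸ t)  ≤⟨ cut-+-≥ (j + t) (q ∸ t) ⟩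
            cut (j + t + (q ∸ t))      ≡⟨ cong cut (trans (+-assoc j t _) (cong (j +_) (m+[n∸m]≡n (≤-trans (m≤m+n t 4) t+4≤q)))) ⟩
            cut (j + q)                ∎
          where open ≤-Reasoning
        bound : cut (j + t) + R ≤ i + P
        bound = +-cancelʳ-≤ 16 _ _ (begin
            cut (j + t) + R + 16        ≡⟨ +-swapʳ (cut (j + t)) R 16 ⟩
            cut (j + t) + 16 + R        ≤⟨ +-monoˡ-≤ R 16≤ ⟩
            cut (j + q) + R             ≡⟨ cong (_+ R) cq≡ ⟩
            cut j + p + R               ≤⟨ +-monoˡ-≤ R (+-monoˡ-≤ p c≤i+9) ⟩
            i + 9 + p + R               ≡⟨ +-assoc (i + 9) p R ⟩
            i + 9 + (p + R)             ≤⟨ +-monoʳ-≤ (i + 9) p+R≤P+7 ⟩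
            i + 9 + (P + 7)             ≡⟨ regroup i P ⟩
            i + P + 16                  ∎)
          where
          open ≤-Reasoning
          regroup : ∀ i P → i + 9 + (P + 7) ≡ i + P + 16
          regroup = solve-∀

    desubstitute : Σ ℕ λ j → Σ ℕ λ q → 4 * q ≤ p × p ≤ 5 * q × Repetition x j q (q ∸ 3)
    desubstitute with first-cut
    ... | j , i+5≤c , c≤i+9 with partner-cut j i+5≤c c≤i+9
    ...   | j′ , c′≡ , x≡ = j , repetition-from-cuts j j′ i+5≤c c≤i+9 c′≡ x≡

module Gdesub = Desubstitution g g-≥4 g-≤5 gInf gInf gInf-image factors₄ factor₄ 3 (≤ᵇ⇒≤ 3 5 tt) decode-g g-decodes-cuts
module Hdesub = Desubstitution h h-≥4 h-≤5 gInf hInf hInf-image factors₄ factor₄ 5 ≤-refl decode-h h-decodes-cuts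

inside-g-image : ∀ n m → n + 4 ≤ 4 * m → ∀ i → Σ ℕ λ j → Infix (window gInf i n) (morph g (window gInf j m))
inside-g-image n m n+4≤4m i = proj₁ found , proj₁ (proj₂ (proj₂ found))
  where found = Gimage.window-in-block i n m n+4≤4m

inside-g³ : ∀ i → Σ ℕ λ j → Infix (window gInf i 136) (morph g (morph g (morph g (window gInf j 4))))
inside-g³ i = j₃ , infix-trans {u = W} {s = morph g V₁} {t = morph g (morph g (morph g V₃))} I₁
                     (infix-trans {u = morph g V₁} {s = morph g (morph g V₂)} (infix-morph g I₂) (infix-morph g (infix-morph g I₃)))
  where
  W = window gInf i 136
  step₁ = inside-g-image 136 36 (≤ᵇ⇒≤ 140 144 tt) i
  j₁ = proj₁ step₁
  V₁ = window gInf j₁ 36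
  I₁ = proj₂ step₁
  step₂ = inside-g-image 36 11 (≤ᵇ⇒≤ 40 44 tt) j₁
  j₂ = proj₁ step₂
  V₂ = window gInf j₂ 11
  I₂ = proj₂ step₂
  step₃ = inside-g-image 11 4 (≤ᵇ⇒≤ 15 16 tt) j₂
  j₃ = proj₁ step₃
  V₃ = window gInf j₃ 4
  I₃ = proj₂ step₃

inside-hg² : ∀ i → Σ ℕ λ j → Infix (window hInf i 162) (morph h (morph g (morph g (window gInf j 5))))
inside-hg² i = j₃ , infix-trans {u = W} {s = morph h V₁} {t = morph h (morph g (morph g V₃))} I₁
                     (infix-trans {u = morph h V₁} {s = morph h (morph g V₂)} (infix-morph h I₂) (infix-morph h (infix-morph g I₃)))
  where
  W = window hInf i 162
  step₁ = Himage.window-in-block i 162 42 (≤ᵇ⇒≤ 166 168 tt)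
  j₁ = proj₁ step₁
  V₁ = window gInf j₁ 42
  I₁ = proj₁ (proj₂ (proj₂ step₁))
  step₂ = inside-g-image 42 12 (≤ᵇ⇒≤ 46 48 tt) j₁
  j₂ = proj₁ step₂
  V₂ = window gInf j₂ 12
  I₂ = proj₂ step₂
  step₃ = inside-g-image 12 5 (≤ᵇ⇒≤ 16 20 tt) j₂
  j₃ = proj₁ step₃
  V₃ = window gInf j₃ 5
  I₃ = proj₂ step₃

-- Certificate: in g³(v), v a length-4 factor, no repetition with period 14 ≤ q < 70 has length q ∸ 3.
short-repetitions-g : List A6 → Bool
short-repetitions-g s = all (λ q → L₆.allSuffixes (λ σ δ → L₆.commonPrefix σ δ <ᵇ q ∸ 3) s (drop q s)) (range 14 56)

g³-ok : List A6 → Bool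
g³-ok v = short-repetitions-g (morph g (morph g (morph g v)))

g³-certificate : all g³-ok factors₄ ≡ true
g³-certificate = refl

fifth-≥ : ∀ {q p} → 70 ≤ p → p ≤ 5 * q → 14 ≤ q
fifth-≥ {q} 70≤p p≤5q = ≮⇒≥ (λ q<14 → <⇒≱ (≤-trans (s≤s (*-monoʳ-≤ 5 (≤-pred q<14))) (≤ᵇ⇒≤ 66 70 tt)) (≤-trans 70≤p p≤5q))

quarter-< : ∀ {q p} → 1 ≤ q → 4 * q ≤ p → q < p
quarter-< {q} 1≤q 4q≤p = <-≤-trans (m<m+n q 1≤q) (≤-trans (+-monoʳ-≤ q (m≤m+n q _)) 4q≤p)

no-repetition-g-base : ∀ q i → 14 ≤ q → q < 70 → ¬ Repetition gInf i q (q ∸ 3)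
no-repetition-g-base q i 14≤q q<70 rep = <⇒≱ short long
  where
  found = inside-g³ i
  s = morph g (morph g (morph g (window gInf (proj₁ found) 4)))
  I = proj₂ found
  k = offset I
  short-at : ℕ → List A6 → List A6 → Bool
  short-at q σ δ = L₆.commonPrefix σ δ <ᵇ q ∸ 3
  all-q : T (short-repetitions-g s)
  all-q = check-all g³-ok factors₄ g³-certificate (factor₄ (proj₁ found))
  at-q : T (L₆.allSuffixes (short-at q) s (drop q s))
  at-q = subst (λ q → T (L₆.allSuffixes (short-at q) s (drop q s))) (m+[n∸m]≡n 14≤q)
           (check-range (λ q → L₆.allSuffixes (short-at q) s (drop q s)) 14 56 all-q (q ∸ 14)
              (+-cancelˡ-< 14 _ _ (subst (_< 70) (sym (m+[n∸m]≡n 14≤q)) q<70)))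
  k<s : k < length s
  k<s = <-≤-trans (m<m+n k z<s) (subst (λ n → k + n ≤ length s) (length-window gInf i 136) (infix-length {u = window gInf i 136} {s = s} I))
  short : L₆.commonPrefix (drop k s) (drop k (drop q s)) < q ∸ 3
  short = <ᵇ⇒< (L₆.commonPrefix (drop k s) (drop k (drop q s))) (q ∸ 3) (L₆.allSuffixes-sound (short-at q) s (drop q s) at-q k k<s)
  long : q ∸ 3 ≤ L₆.commonPrefix (drop k s) (drop k (drop q s))
  long = L₆.repetition⇒commonPrefix a gInf i 136 q (q ∸ 3) s I fits rep
    where
    fits : q ∸ 3 + q ≤ 136
    fits = ≤-trans (+-mono-≤ (∸-monoˡ-≤ 3 (≤-pred q<70)) (≤-pred q<70)) (≤ᵇ⇒≤ 135 136 tt)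

-- g^∞(a) has no repetition of period q ≥ 14 and length q ∸ 3: periods below 70 by the certificate,
-- larger ones by desubstitution to a smaller such period.
no-repetition-g : ∀ q → 14 ≤ q → ∀ i → ¬ Repetition gInf i q (q ∸ 3)
no-repetition-g = <-rec (λ q → 14 ≤ q → ∀ i → ¬ Repetition gInf i q (q ∸ 3)) step
  where
  step : ∀ q → (∀ {q′} → q′ < q → 14 ≤ q′ → ∀ i → ¬ Repetition gInf i q′ (q′ ∸ 3)) →
         14 ≤ q → ∀ i → ¬ Repetition gInf i q (q ∸ 3)
  step q IH 14≤q i rep with q <? 70
  ... | yes q<70 = no-repetition-g-base q i 14≤q q<70 rep
  ... | no  q≮70 = IH q′<q 14≤q′ j rep′
    where
    70≤q : 70 ≤ q
    70≤q = ≮⇒≥ q≮70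
    fits : 9 + 3 ≤ q ∸ 3
    fits = m+n≤o⇒m≤o∸n 12 (≤-trans (≤ᵇ⇒≤ 15 70 tt) 70≤q)
    within : q + 3 ≤ q ∸ 3 + 7
    within = subst (q + 3 ≤_) (sym (q∸3+7 q (≤-trans (≤ᵇ⇒≤ 3 70 tt) 70≤q))) (+-monoʳ-≤ q (n≤1+n 3))
      where
      q∸3+7 : ∀ q → 3 ≤ q → q ∸ 3 + 7 ≡ q + 4
      q∸3+7 q 3≤q = trans (+-comm (q ∸ 3) 7) (trans (sym (+-∸-assoc 7 3≤q)) (trans (cong (_∸ 3) (+-comm 7 q)) (+-∸-assoc q {7} {3} (≤ᵇ⇒≤ 3 7 tt))))
    desub = Gdesub.desubstitute {i} {q} {q ∸ 3} (≤-trans (≤ᵇ⇒≤ 1 14 tt) 14≤q) fits within rep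
    j = proj₁ desub
    q′ = proj₁ (proj₂ desub)
    4q′≤q = proj₁ (proj₂ (proj₂ desub))
    q≤5q′ = proj₁ (proj₂ (proj₂ (proj₂ desub)))
    rep′ = proj₂ (proj₂ (proj₂ (proj₂ desub)))
    14≤q′ : 14 ≤ q′
    14≤q′ = fifth-≥ 70≤q q≤5q′
    q′<q : q′ < q
    q′<q = quarter-< (≤-trans (≤ᵇ⇒≤ 1 14 tt) 14≤q′) 4q′≤q

square-roots : List (List Bit)
square-roots =
  (b0 ∷ []) ∷ (b1 ∷ []) ∷ (b0 ∷ b1 ∷ []) ∷ (b1 ∷ b0 ∷ []) ∷
  (b0 ∷ b0 ∷ b1 ∷ []) ∷ (b0 ∷ b1 ∷ b0 ∷ []) ∷ (b0 ∷ b1 ∷ b1 ∷ []) ∷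
  (b1 ∷ b0 ∷ b0 ∷ []) ∷ (b1 ∷ b0 ∷ b1 ∷ []) ∷ (b1 ∷ b1 ∷ b0 ∷ []) ∷
  (b0 ∷ b1 ∷ b1 ∷ b0 ∷ b1 ∷ b0 ∷ b0 ∷ b1 ∷ []) ∷
  (b1 ∷ b0 ∷ b0 ∷ b1 ∷ b0 ∷ b1 ∷ b1 ∷ b0 ∷ []) ∷ []

overlaps : List (List Bit)
overlaps = (b0 ∷ b1 ∷ b1 ∷ b0 ∷ b1 ∷ b1 ∷ b0 ∷ []) ∷ (b1 ∷ b0 ∷ b0 ∷ b1 ∷ b0 ∷ b0 ∷ b1 ∷ []) ∷ []

-- Certificate for 𝐡: a repetition of period p and length ℓ at the start of σ has exponent at most 7/3,
-- is one of the listed squares if ℓ ≥ p, and one of the listed overlaps if ℓ > p.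
exponent-ok : ℕ → ℕ → Bool
exponent-ok p ℓ = 3 * (ℓ + p) ≤ᵇ 7 * p

square-ok : ℕ → ℕ → List Bit → Bool
square-ok p ℓ σ = (p ≤ᵇ ℓ) ⇒ᵇ (take p σ L₂.∈ᵇ square-roots)

overlap-ok : ℕ → ℕ → List Bit → Bool
overlap-ok p ℓ σ = (suc p ≤ᵇ ℓ) ⇒ᵇ (take (suc (2 * p)) σ L₂.∈ᵇ overlaps)

repetition-ok : ℕ → ℕ → List Bit → Bool
repetition-ok p ℓ σ = exponent-ok p ℓ ∧ (square-ok p ℓ σ ∧ overlap-ok p ℓ σ)

h-repetition-ok : ℕ → List Bit → List Bit → Bool
h-repetition-ok p σ δ = repetition-ok p (L₂.commonPrefix σ δ) σ

h-certificate-for : List Bit → Bool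
h-certificate-for s = all (λ p → L₂.allSuffixes (h-repetition-ok p) s (drop p s)) (range 1 69)

hg²-ok : List A6 → Bool
hg²-ok v = h-certificate-for (morph h (morph g (morph g v)))

hg²-certificate : all hg²-ok factors₅ ≡ true
hg²-certificate = refl

short-period-facts : ∀ p i P → 1 ≤ p → p < 70 → P ≤ 93 → Repetition hInf i p P →
  3 * (P + p) ≤ 7 * p × (p ≤ P → window hInf i p ∈ square-roots) × (suc p ≤ P → window hInf i (suc (2 * p)) ∈ overlaps)
short-period-facts p i P 1≤p p<70 P≤93 rep = bound , square , overlapping
  where
  found = inside-hg² i
  s = morph h (morph g (morph g (window gInf (proj₁ found) 5)))
  W = window hInf i 162
  I : Infix W s
  I = proj₂ found
  k = offset I
  σ = drop k s
  δ = drop k (drop p s)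
  ℓ = L₂.commonPrefix σ δ
  at-p : T (L₂.allSuffixes (h-repetition-ok p) s (drop p s))
  at-p = subst (λ p → T (L₂.allSuffixes (h-repetition-ok p) s (drop p s))) (m+[n∸m]≡n 1≤p)
           (check-range (λ p → L₂.allSuffixes (h-repetition-ok p) s (drop p s)) 1 69
              (check-all hg²-ok factors₅ hg²-certificate (factor₅ (proj₁ found)))
              (p ∸ 1) (+-cancelˡ-< 1 _ _ (subst (_< 70) (sym (m+[n∸m]≡n 1≤p)) p<70)))
  k<s : k < length s
  k<s = <-≤-trans (m<m+n k z<s) (subst (λ n → k + n ≤ length s) (length-window hInf i 162) (infix-length {u = W} {s = s} I))
  ok : T (h-repetition-ok p σ δ)
  ok = L₂.allSuffixes-sound (h-repetition-ok p) s (drop p s) at-p k k<s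
  ok₁ : T (exponent-ok p ℓ)
  ok₁ = proj₁ (∧-split {exponent-ok p ℓ} ok)
  ok₂₃ : T (square-ok p ℓ σ ∧ overlap-ok p ℓ σ)
  ok₂₃ = proj₂ (∧-split {exponent-ok p ℓ} ok)
  ok₂ : T (square-ok p ℓ σ)
  ok₂ = proj₁ (∧-split {square-ok p ℓ σ} ok₂₃)
  ok₃ : T (overlap-ok p ℓ σ)
  ok₃ = proj₂ (∧-split {square-ok p ℓ σ} ok₂₃)
  P≤ℓ : P ≤ ℓ
  P≤ℓ = L₂.repetition⇒commonPrefix b0 hInf i 162 p P s I (≤-trans (+-mono-≤ P≤93 (≤-pred p<70)) (≤ᵇ⇒≤ 162 162 tt)) rep
  σ-prefix : ∀ m → m ≤ 162 → take m σ ≡ window hInf i m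
  σ-prefix m m≤162 = trans (cong (take m) (infix-suffix {u = W} {s = s} I))
    (trans (take-++ˡ m W _ (subst (m ≤_) (sym (length-window hInf i 162)) m≤162)) (take-window hInf i m 162 m≤162))
  bound : 3 * (P + p) ≤ 7 * p
  bound = ≤-trans (*-monoʳ-≤ 3 (+-monoˡ-≤ p P≤ℓ)) (≤ᵇ⇒≤ (3 * (ℓ + p)) (7 * p) ok₁)
  square : p ≤ P → window hInf i p ∈ square-roots
  square p≤P = subst (_∈ square-roots) (σ-prefix p (≤-trans (<⇒≤ p<70) (≤ᵇ⇒≤ 70 162 tt)))
    (L₂.∈ᵇ-sound (take p σ) square-roots (⇒ᵇ-mp {p ≤ᵇ ℓ} ok₂ (≤⇒≤ᵇ (≤-trans p≤P P≤ℓ))))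
  overlapping : suc p ≤ P → window hInf i (suc (2 * p)) ∈ overlaps
  overlapping p<P = subst (_∈ overlaps) (σ-prefix (suc (2 * p)) (≤-trans (s≤s (*-monoʳ-≤ 2 (≤-pred p<70))) (≤ᵇ⇒≤ 139 162 tt)))
    (L₂.∈ᵇ-sound (take (suc (2 * p)) σ) overlaps (⇒ᵇ-mp {suc p ≤ᵇ ℓ} ok₃ (≤⇒≤ᵇ (≤-trans p<P P≤ℓ))))

-- 𝐡 has no square of period p ≥ 70: it would desubstitute to a forbidden repetition of g^∞(a).
no-long-square-h : ∀ p → 70 ≤ p → ∀ i → ¬ Repetition hInf i p p
no-long-square-h p 70≤p i rep = no-repetition-g q (fifth-≥ 70≤p p≤5q) j rep′
  where
  desub = Hdesub.desubstitute {i} {p} {p} (≤-trans (≤ᵇ⇒≤ 1 70 tt) 70≤p) (≤-trans (≤ᵇ⇒≤ 14 70 tt) 70≤p)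
                              (+-monoʳ-≤ p (≤ᵇ⇒≤ 5 7 tt)) rep
  j = proj₁ desub
  q = proj₁ (proj₂ desub)
  p≤5q = proj₁ (proj₂ (proj₂ (proj₂ desub)))
  rep′ = proj₂ (proj₂ (proj₂ (proj₂ desub)))

repetition-bound-h : ∀ i p P → 1 ≤ p → Repetition hInf i p P → 3 * (P + p) ≤ 7 * p
repetition-bound-h i p P 1≤p rep with p <? 70
... | no p≮70 = ≤-trans (*-monoʳ-≤ 3 (+-monoˡ-≤ p P≤p)) (twice-≤ p)
  where
  P≤p : P ≤ p
  P≤p = ≮⇒≥ (λ p<P → no-long-square-h p (≮⇒≥ p≮70) i (repetition-≤ {x = hInf} {i} {p} (<⇒≤ p<P) rep))
  twice-≤ : ∀ p → 3 * (p + p) ≤ 7 * p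
  twice-≤ p = subst (3 * (p + p) ≤_) (sym (six+one p)) (m≤m+n _ p)
    where
    six+one : ∀ p → 7 * p ≡ 3 * (p + p) + p
    six+one = solve-∀
... | yes p<70 with P ≤? 93
...   | yes P≤93 = proj₁ (short-period-facts p i P 1≤p p<70 P≤93 rep)
...   | no  P≰93 = ⊥-elim (<⇒≱ too-long (proj₁ (short-period-facts p i 93 1≤p p<70 ≤-refl (repetition-≤ {x = hInf} {i} {p} (<⇒≤ (≰⇒> P≰93)) rep))))
  where
  too-long : 7 * p < 3 * (93 + p)
  too-long = subst₂ _<_ (sym (split₁ p)) (sym (split₂ p))
    (+-monoˡ-< (3 * p) (≤-trans (s≤s (*-monoʳ-≤ 4 (≤-pred p<70))) (≤ᵇ⇒≤ 277 279 tt)))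
    where
    split₁ : ∀ p → 7 * p ≡ 4 * p + 3 * p
    split₁ = solve-∀
    split₂ : ∀ p → 3 * (93 + p) ≡ 279 + 3 * p
    split₂ = solve-∀

exponent-bound : ∀ (w : List Bit) (p : ℕ) → IsFactor hInf w → HasPeriod w p → 3 * length w ≤ 7 * p
exponent-bound w p occurs period =
  ≤-trans (*-monoʳ-≤ 3 (subst (length w ≤_) (+-comm p _) (m≤n+m∸n (length w) p)))
          (repetition-bound-h i p (length w ∸ p) (proj₁ period) (periodic-window hInf w i p w≡ period))
  where
  i = proj₁ (factor⇒window hInf w occurs)
  w≡ = proj₂ (factor⇒window hInf w occurs)

square-root : ∀ u → u ≢ [] → IsFactor hInf (u ++ u) → u ∈ square-roots
square-root u u≢[] occurs = subst (_∈ square-roots) window≡u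
  (proj₁ (proj₂ (short-period-facts p i p 1≤p p<70 (≤-trans (<⇒≤ p<70) (≤ᵇ⇒≤ 70 93 tt)) rep)) ≤-refl)
  where
  p = length u
  i = proj₁ (factor⇒window hInf (u ++ u) occurs)
  uu≡ : u ++ u ≡ window hInf i (length (u ++ u))
  uu≡ = proj₂ (factor⇒window hInf (u ++ u) occurs)
  1≤p : 1 ≤ p
  1≤p = proj₁ (square-period u u≢[])
  length-uu : length (u ++ u) ∸ p ≡ p
  length-uu = trans (cong (_∸ p) (length-++ u)) (m+n∸m≡n p p)
  rep : Repetition hInf i p p
  rep = subst (Repetition hInf i p) length-uu (periodic-window hInf (u ++ u) i p uu≡ (square-period u u≢[]))
  p<70 : p < 70
  p<70 = ≰⇒> (λ 70≤p → no-long-square-h p 70≤p i rep)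
  window≡u : window hInf i p ≡ u
  window≡u = begin
      window hInf i p                              ≡⟨ take-window hInf i p _ (subst (p ≤_) (sym (length-++ u)) (m≤m+n p p)) ⟨
      take p (window hInf i (length (u ++ u)))     ≡⟨ cong (take p) uu≡ ⟨
      take p (u ++ u)                              ≡⟨ take-length-++ u u ⟩
      u                                            ∎
    where open ≡-Reasoning

square-occurs : ∀ u → u ∈ square-roots → IsFactor hInf (u ++ u)
square-occurs _ (here refl)                                                                     = 1 , refl
square-occurs _ (there (here refl))                                                             = 3 , refl
square-occurs _ (there (there (here refl)))                                                     = 18 , refl
square-occurs _ (there (there (there (here refl))))                                             = 14 , refl
square-occurs _ (there (there (there (there (here refl)))))                                     = 8 , refl
square-occurs _ (there (there (there (there (there (here refl))))))                             = 15 , refl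
square-occurs _ (there (there (there (there (there (there (here refl)))))))                     = 2 , refl
square-occurs _ (there (there (there (there (there (there (there (here refl))))))))             = 7 , refl
square-occurs _ (there (there (there (there (there (there (there (there (here refl)))))))))     = 35 , refl
square-occurs _ (there (there (there (there (there (there (there (there (there (here refl)))))))))) = 3 , refl
square-occurs _ (there (there (there (there (there (there (there (there (there (there (here refl))))))))))) = 52 , refl
square-occurs _ (there (there (there (there (there (there (there (there (there (there (there (here refl)))))))))))) = 71 , refl

overlap-occurs : ∀ {w} → w ∈ overlaps → IsFactor hInf w
overlap-occurs (here refl)         = 2 , refl
overlap-occurs (there (here refl)) = 7 , refl

overlap-length : ∀ {w} → w ∈ overlaps → length w ≡ 7
overlap-length (here refl)         = refl
overlap-length (there (here refl)) = refl

overlap-period : ∀ {w} → w ∈ overlaps → HasPeriod w 3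
overlap-period {w} w∈ = s≤s z≤n , λ t t+3<7 → shift w∈ t (+-cancelʳ-< 3 t 4 (subst (t + 3 <_) (overlap-length w∈) t+3<7))
  where
  shift : ∀ {w} → w ∈ overlaps → ∀ t → t < 4 → ∀ x → lookupD x w t ≡ lookupD x w (t + 3)
  shift (here refl)         0 _ _ = refl
  shift (here refl)         1 _ _ = refl
  shift (here refl)         2 _ _ = refl
  shift (here refl)         3 _ _ = refl
  shift (there (here refl)) 0 _ _ = refl
  shift (there (here refl)) 1 _ _ = refl
  shift (there (here refl)) 2 _ _ = refl
  shift (there (here refl)) 3 _ _ = refl
  shift _ (suc (suc (suc (suc t)))) (s≤s (s≤s (s≤s (s≤s ())))) _

-- A factor with period p and length above 2p contains a repetition of length p + 1; by the certificate
-- its prefix of length 2p + 1 is an overlap, so p = 3, and the exponent bound forces length 7.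
overlap-only : ∀ w p → HasPeriod w p → IsFactor hInf w → 2 * p < length w → w ∈ overlaps
overlap-only w p period occurs 2p<L = subst (_∈ overlaps) (sym w≡v) v∈
  where
  i = proj₁ (factor⇒window hInf w occurs)
  w≡ : w ≡ window hInf i (length w)
  w≡ = proj₂ (factor⇒window hInf w occurs)
  L = length w
  1≤p = proj₁ period
  rep : Repetition hInf i p (L ∸ p)
  rep = periodic-window hInf w i p w≡ period
  p<L∸p : suc p ≤ L ∸ p
  p<L∸p = m+n≤o⇒m≤o∸n (suc p) (subst (_≤ L) (cong suc (cong (p +_) (+-identityʳ p))) 2p<L)
  p<70 : p < 70
  p<70 = ≰⇒> (λ 70≤p → no-long-square-h p 70≤p i (repetition-≤ {x = hInf} {i} {p} (≤-trans (n≤1+n p) p<L∸p) rep))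
  v = window hInf i (suc (2 * p))
  v∈ : v ∈ overlaps
  v∈ = proj₂ (proj₂ (short-period-facts p i (suc p) 1≤p p<70 (≤-trans p<70 (≤ᵇ⇒≤ 70 93 tt))
                       (repetition-≤ {x = hInf} {i} {p} p<L∸p rep))) ≤-refl
  2p+1≡7 : suc (2 * p) ≡ 7
  2p+1≡7 = trans (sym (length-window hInf i (suc (2 * p)))) (overlap-length v∈)
  p≡3 : p ≡ 3
  p≡3 = *-cancelˡ-≡ p 3 2 (suc-injective 2p+1≡7)
  L≡7 : L ≡ 7
  L≡7 = ≤-antisym (*-cancelˡ-≤ 3 (subst (λ q → 3 * L ≤ 7 * q) p≡3 (exponent-bound w p occurs period)))
                  (subst (λ q → 2 * q < L) p≡3 2p<L)
  w≡v : w ≡ v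
  w≡v = trans w≡ (cong (window hInf i) (trans L≡7 (sym 2p+1≡7)))

proposition2 :
    (∀ (w : List Bit) (p : ℕ) → IsFactor hInf w → w ≢ [] → SmallestPeriod w p →
       3 * length w ≤ 7 * p)
    ×
    (∀ (u : List Bit) → u ≢ [] →
       (IsFactor hInf (u ++ u) ⇔
         (u ∈ ((b0 ∷ []) ∷ (b1 ∷ []) ∷ (b0 ∷ b1 ∷ []) ∷ (b1 ∷ b0 ∷ []) ∷
               (b0 ∷ b0 ∷ b1 ∷ []) ∷ (b0 ∷ b1 ∷ b0 ∷ []) ∷ (b0 ∷ b1 ∷ b1 ∷ []) ∷
               (b1 ∷ b0 ∷ b0 ∷ []) ∷ (b1 ∷ b0 ∷ b1 ∷ []) ∷ (b1 ∷ b1 ∷ b0 ∷ []) ∷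
               (b0 ∷ b1 ∷ b1 ∷ b0 ∷ b1 ∷ b0 ∷ b0 ∷ b1 ∷ []) ∷
               (b1 ∷ b0 ∷ b0 ∷ b1 ∷ b0 ∷ b1 ∷ b1 ∷ b0 ∷ []) ∷ []))))
    ×
    (∀ (w : List Bit) (p : ℕ) → w ≢ [] → SmallestPeriod w p →
       ((IsFactor hInf w × 2 * p < length w) ⇔
         ((w ≡ b0 ∷ b1 ∷ b1 ∷ b0 ∷ b1 ∷ b1 ∷ b0 ∷ []) ⊎
          (w ≡ b1 ∷ b0 ∷ b0 ∷ b1 ∷ b0 ∷ b0 ∷ b1 ∷ []))))
proposition2 =
    (λ w p occurs _ (period , _) → exponent-bound w p occurs period)
  , (λ u u≢[] → mk⇔ (square-root u u≢[]) (square-occurs u))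
  , (λ w p _ (period , smallest) → mk⇔ (λ (occurs , 2p<L) → which (overlap-only w p period occurs 2p<L))
                                        (λ w≡ → let w∈ = is-overlap w≡ in overlap-occurs w∈ , short (smallest 3 (overlap-period w∈)) w∈))
  where
  which : ∀ {w} → w ∈ overlaps → (w ≡ b0 ∷ b1 ∷ b1 ∷ b0 ∷ b1 ∷ b1 ∷ b0 ∷ []) ⊎ (w ≡ b1 ∷ b0 ∷ b0 ∷ b1 ∷ b0 ∷ b0 ∷ b1 ∷ [])
  which (here w≡)         = inj₁ w≡
  which (there (here w≡)) = inj₂ w≡
  is-overlap : ∀ {w} → (w ≡ b0 ∷ b1 ∷ b1 ∷ b0 ∷ b1 ∷ b1 ∷ b0 ∷ []) ⊎ (w ≡ b1 ∷ b0 ∷ b0 ∷ b1 ∷ b0 ∷ b0 ∷ b1 ∷ []) → w ∈ overlaps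
  is-overlap (inj₁ w≡) = here w≡
  is-overlap (inj₂ w≡) = there (here w≡)
  short : ∀ {w p} → p ≤ 3 → w ∈ overlaps → 2 * p < length w
  short p≤3 w∈ = subst (_ <_) (sym (overlap-length w∈)) (s≤s (*-monoʳ-≤ 2 p≤3))
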